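{- Let $n$ be a positive integer, let $M$ be a partial matching of $K_{n,n}$ covering $2d$ vertices, and let $d\le k\le n$. Then $$x_M\equiv_{(\mathcal Q_n,k)}\frac{1}{\binom{n-d}{k-d}}\sum_{M'\supseteq M,\ |M'|=k}x_{M'},$$ the sum ranging over partial matchings $M'$ of $K_{n,n}$ with $k$ edges containing $M$.
   Context: $x_{ij}$ corresponds to the edge between left vertex $i$ and right vertex $j$ of $K_{n,n}$; $x_M=\prod_{e\in M}x_e$. $\mathcal Q_n=\{\sum_i x_{ij}-1: j\}\cup\{\sum_j x_{ij}-1: i\}\cup\{x_{ij}x_{il}: j\ne l\}\cup\{x_{ij}x_{lj}: i\ne l\}\cup\{x_{ij}^2-x_{ij}\}$. $F\equiv_{(\mathcal P,d)}G$ means there exist polynomials $q(p)$ with $F+\sum_p q(p)p=G$ and $\max_p\deg(q(p)p)\le d$. -}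

module Defs where

open import Data.Nat as ℕ using (ℕ; zero; suc; _≤_; _<_; _∸_)
open import Data.Nat.Combinatorics using (_C_)
open import Data.Integer using (+_)
open import Data.Rational as ℚ using (ℚ; 0ℚ; 1ℚ)
open import Data.Fin using (Fin; zero; suc)
import Data.Fin as Fin
open import Data.Fin.Properties using (all?)
import Data.Fin.Properties as FinP
import Relation.Nullary
open import Data.Bool using (Bool; true; false; if_then_else_; _∨_; _∧_)
import Data.Bool.Properties as BoolP
open import Data.Product using (Σ; _×_; _,_)
open import Data.List using (List; []; _∷_; _++_; map; concatMap; filter)
import Data.List as List
open import Data.List.Relation.Unary.All using (All)
open import Relation.Binary.PropositionalEquality using (_≡_; _≢_)
open import Relation.Nullary using (Dec; yes; no; ¬_)
open import Relation.Nullary.Decidable using (_×-dec_; _→-dec_)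

sumFin : ∀ {n} → (Fin n → ℕ) → ℕ
sumFin {zero}  f = 0
sumFin {suc n} f = f zero ℕ.+ sumFin (λ i → f (suc i))

anyFin : ∀ {n} → (Fin n → Bool) → Bool
anyFin {zero}  f = false
anyFin {suc n} f = f zero ∨ anyFin (λ i → f (suc i))

-- Polynomials over ℚ in the n² variables x_{ij}, i,j ∈ Fin n
-- (i = left vertex, j = right vertex of K_{n,n}).

Mono : ℕ → Set
Mono n = Fin n → Fin n → ℕ

-- A polynomial is a finite formal sum of terms (coefficient, monomial);
-- its meaning is its coefficient function `coeff`, and two polynomials
-- are equal when all their coefficients agree.
Poly : ℕ → Set
Poly n = List (ℚ × Mono n)

_≟ₘ_ : ∀ {n} (m m′ : Mono n) → Dec (∀ i j → m i j ≡ m′ i j)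
m ≟ₘ m′ = all? (λ i → all? (λ j → m i j ℕ.≟ m′ i j))

coeff : ∀ {n} → Poly n → Mono n → ℚ
coeff []               m = 0ℚ
coeff ((c , m′) ∷ p)   m with m′ ≟ₘ m
... | yes _ = c ℚ.+ coeff p m
... | no  _ = coeff p m

_≈ₚ_ : ∀ {n} → Poly n → Poly n → Set
p ≈ₚ q = ∀ m → coeff p m ≡ coeff q m

_+ₚ_ : ∀ {n} → Poly n → Poly n → Poly n
p +ₚ q = p ++ q

_*ₚ_ : ∀ {n} → Poly n → Poly n → Poly n
p *ₚ q = concatMap (λ { (c , m) → map (λ { (c′ , m′) → (c ℚ.* c′ , λ i j → m i j ℕ.+ m′ i j) }) q }) p

constₚ : ∀ {n} → ℚ → Poly n
constₚ c = (c , λ _ _ → 0) ∷ []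

var : ∀ {n} → Fin n → Fin n → Poly n
var i j = (1ℚ , λ i′ j′ → if (Relation.Nullary.does (i′ FinP.≟ i) ∧ Relation.Nullary.does (j′ FinP.≟ j)) then 1 else 0) ∷ []

sumₚ : ∀ {n} → (Fin n → Poly n) → Poly n
sumₚ {n} f = concatMap f (List.allFin n)

totalDeg : ∀ {n} → Mono n → ℕ
totalDeg m = sumFin (λ i → sumFin (λ j → m i j))

-- deg p ≤ d (the zero polynomial has degree ≤ d for every d)
DegLE : ∀ {n} → Poly n → ℕ → Set
DegLE p d = ∀ m → ¬ (coeff p m ≡ 0ℚ) → totalDeg m ≤ d

data Axiom (n : ℕ) : Set where
  colSum  : (j : Fin n) → Axiom n
  rowSum  : (i : Fin n) → Axiom n
  rowPair : (i j l : Fin n) → j ≢ l → Axiom n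
  colPair : (i l j : Fin n) → i ≢ l → Axiom n
  boolAx  : (i j : Fin n) → Axiom n

axPoly : ∀ {n} → Axiom n → Poly n
axPoly (colSum j)        = sumₚ (λ i → var i j) +ₚ constₚ (ℚ.- 1ℚ)
axPoly (rowSum i)        = sumₚ (λ j → var i j) +ₚ constₚ (ℚ.- 1ℚ)
axPoly (rowPair i j l _) = var i j *ₚ var i l
axPoly (colPair i l j _) = var i j *ₚ var l j
axPoly (boolAx i j)      = (var i j *ₚ var i j) +ₚ (constₚ (ℚ.- 1ℚ) *ₚ var i j)

-- F ≡_{(𝒬_n , d)} G : there are multipliers q(p) (listed as pairs
-- (axiom p , q(p)); repeated axioms are allowed, which is equivalent)
-- with F + Σ q(p) p = G and deg(q(p) p) ≤ d for each p.
Derives : (n d : ℕ) → Poly n → Poly n → Set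
Derives n d F G =
  Σ (List (Axiom n × Poly n)) λ L →
    All (λ { (a , q) → DegLE (q *ₚ axPoly a) d }) L ×
    ((F +ₚ concatMap (λ { (a , q) → q *ₚ axPoly a }) L) ≈ₚ G)

EdgeSet : ℕ → Set
EdgeSet n = Fin n → Fin n → Bool

IsMatching : ∀ {n} → EdgeSet n → Set
IsMatching M =
  (∀ i j l → M i j ≡ true → M i l ≡ true → j ≡ l) ×
  (∀ i l j → M i j ≡ true → M l j ≡ true → i ≡ l)

isMatching? : ∀ {n} (M : EdgeSet n) → Dec (IsMatching M)
isMatching? M =
  all? (λ i → all? (λ j → all? (λ l →
    (M i j BoolP.≟ true) →-dec (M i l BoolP.≟ true) →-dec (j Data.Fin.Properties.≟ l))))
  ×-dec
  all? (λ i → all? (λ l → all? (λ j →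
    (M i j BoolP.≟ true) →-dec (M l j BoolP.≟ true) →-dec (i Data.Fin.Properties.≟ l))))
  where import Data.Fin.Properties

_⊆ₑ_ : ∀ {n} → EdgeSet n → EdgeSet n → Set
M ⊆ₑ M′ = ∀ i j → M i j ≡ true → M′ i j ≡ true

_⊆ₑ?_ : ∀ {n} (M M′ : EdgeSet n) → Dec (M ⊆ₑ M′)
M ⊆ₑ? M′ = all? (λ i → all? (λ j → (M i j BoolP.≟ true) →-dec (M′ i j BoolP.≟ true)))

edgeCount : ∀ {n} → EdgeSet n → ℕ
edgeCount M = sumFin (λ i → sumFin (λ j → if M i j then 1 else 0))

coveredCount : ∀ {n} → EdgeSet n → ℕ
coveredCount M =
  sumFin (λ i → if anyFin (λ j → M i j) then 1 else 0) ℕ.+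
  sumFin (λ j → if anyFin (λ i → M i j) then 1 else 0)

monoOf : ∀ {n} → EdgeSet n → Mono n
monoOf M i j = if M i j then 1 else 0

xM : ∀ {n} → EdgeSet n → Poly n
xM M = (1ℚ , monoOf M) ∷ []

allFuns : ∀ {A : Set} (m : ℕ) → List A → List (Fin m → A)
allFuns zero    xs = (λ ()) ∷ []
allFuns (suc m) xs =
  concatMap (λ a → map (λ f → λ { zero → a ; (suc i) → f i }) (allFuns m xs)) xs

allEdgeSets : (n : ℕ) → List (EdgeSet n)
allEdgeSets n = allFuns n (allFuns n (true ∷ false ∷ []))

extensions : ∀ {n} → EdgeSet n → ℕ → List (EdgeSet n)
extensions {n} M k =
  filter (λ M′ → isMatching? M′ ×-dec (M ⊆ₑ? M′) ×-dec (edgeCount M′ ℕ.≟ k))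
         (allEdgeSets n)

-- 1/m in ℚ (only used for m ≥ 1; 1/0 := 0 is a junk value)
invℕ : ℕ → ℚ
invℕ zero    = 0ℚ
invℕ (suc m) = + 1 ℚ./ suc m

rhsPoly : (n d k : ℕ) → EdgeSet n → Poly n
rhsPoly n d k M = map (λ M′ → (invℕ ((n ∸ d) C (k ∸ d)) , monoOf M′)) (extensions M k)

module Submission where

-- Write S_j for the sum of the monomials x_E over the partial matchings
-- E ⊇ M with j edges, so that S_d = x_M when |M| = d.  Everything rests on
-- one derivation step of degree j + 1,
--     (n − j) · S_j  ≡  (j + 1 − d) · S_{j+1} .
-- A matching E with j edges leaves n − j rows i free, and the row axiom
-- Σ_b x_ib − 1 rewrites x_E as Σ_b x_E x_ib.  Every product that is not a
-- matching contains a factor x_ij x_il or x_ij x_lj and is cancelled by a pair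
-- axiom; a matching G ⊇ M with j + 1 edges arises once for each of its
-- j + 1 − d edges outside M (delete that edge to recover E).  Iterating the
-- step from j = d to k with the absorption identity
-- (t+1)·C(a,t+1) = (a−t)·C(a,t) gives C(n−d, k−d) · x_M ≡ S_k, and dividing
-- by the binomial coefficient is the theorem.

open import Defs
open import Data.Nat using (ℕ; _≤_; _<_; _*_)
open import Relation.Binary.PropositionalEquality using (_≡_)
open import Data.Nat as N using (zero; suc; _+_; _∸_; z≤n; s≤s)
import Data.Nat.Properties as NP
import Algebra.Properties.CommutativeSemigroup as CommSemigroupProps
import Data.Nat.Solver
open import Data.Nat.Combinatorics using (_C_; nC1≡n; nCk+nC[k+1]≡[n+1]C[k+1]; k>n⇒nCk≡0)
open import Data.Rational as Q using (ℚ; 0ℚ; 1ℚ)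
import Data.Rational.Properties as QP
open import Data.Rational.Solver using (module +-*-Solver)
open import Data.Rational.Unnormalised as U using (mkℚᵘ; *≡*)
import Data.Rational.Unnormalised.Properties as UP
import Data.Integer as Z
import Data.Integer.Properties as ZP
open import Data.Fin using (Fin; zero; suc)
import Data.Fin.Properties as FP
open import Data.Bool using (Bool; true; false; if_then_else_; _∨_; _∧_; not)
import Data.Bool.Properties as BP
open import Data.Product using (Σ; _×_; _,_; proj₁; proj₂)
open import Data.Sum using (_⊎_; inj₁; inj₂)
open import Data.List as L using (List; []; _∷_; _++_; map; concatMap; filter)
import Data.List.Properties as LP
open import Data.List.Relation.Unary.All as All using (All; []; _∷_)
import Data.List.Relation.Unary.All.Properties as AllP
open import Data.Empty using (⊥; ⊥-elim)
open import Relation.Nullary using (Dec; yes; no; ¬_; does)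
open import Relation.Nullary.Decidable using (_×-dec_; _→-dec_)
open import Relation.Binary.PropositionalEquality as Eq using (_≢_; refl; sym; trans; cong; cong₂; subst)
open Eq.≡-Reasoning

open CommSemigroupProps NP.+-commutativeSemigroup using () renaming (interchange to ℕ-interchange)

module ℕS = Data.Nat.Solver.+-*-Solver
open +-*-Solver using (solve; _:=_; _:+_)

infixl 6 _+q_
infixl 7 _*q_
_+q_ : ℚ → ℚ → ℚ
_+q_ = Q._+_
_*q_ : ℚ → ℚ → ℚ
_*q_ = Q._*_

-- ι k is the natural number k as a rational; defined by recursion so that
-- its additivity and multiplicativity follow by induction.
ι : ℕ → ℚ
ι zero    = 0ℚ
ι (suc k) = 1ℚ +q ι k

ι-+ : ∀ a b → ι (a + b) ≡ ι a +q ι b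
ι-+ zero    b = sym (QP.+-identityˡ (ι b))
ι-+ (suc a) b = trans (cong (1ℚ +q_) (ι-+ a b)) (sym (QP.+-assoc 1ℚ (ι a) (ι b)))

ι-* : ∀ a b → ι (a * b) ≡ ι a *q ι b
ι-* zero    b = sym (QP.*-zeroˡ (ι b))
ι-* (suc a) b = begin
  ι (b + a * b)                 ≡⟨ ι-+ b (a * b) ⟩
  ι b +q ι (a * b)              ≡⟨ cong (ι b +q_) (ι-* a b) ⟩
  ι b +q ι a *q ι b             ≡⟨ cong (_+q ι a *q ι b) (sym (QP.*-identityˡ (ι b))) ⟩
  1ℚ *q ι b +q ι a *q ι b       ≡⟨ sym (QP.*-distribʳ-+ (ι b) 1ℚ (ι a)) ⟩
  (1ℚ +q ι a) *q ι b            ∎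

ι≃k/1 : ∀ k → Q.toℚᵘ (ι k) U.≃ mkℚᵘ (Z.+ k) 0
ι≃k/1 zero    = *≡* refl
ι≃k/1 (suc k) = UP.≃-trans (QP.toℚᵘ-homo-+ 1ℚ (ι k))
  (UP.≃-trans (UP.+-congʳ (mkℚᵘ (Z.+ 1) 0) (ι≃k/1 k)) one+k)
  where
  one+k : (mkℚᵘ (Z.+ 1) 0 U.+ mkℚᵘ (Z.+ k) 0) U.≃ mkℚᵘ (Z.+ suc k) 0
  one+k = *≡* (cong (Z._* Z.+ 1) (cong (Z._+_ (Z.+ 1)) (ZP.*-identityʳ (Z.+ k))))

invℕ-inverse : ∀ m → invℕ (suc m) *q ι (suc m) ≡ 1ℚ
invℕ-inverse m = QP.toℚᵘ-injective (UP.≃-trans (QP.toℚᵘ-homo-* (invℕ (suc m)) (ι (suc m)))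
  (UP.≃-trans (UP.*-cong (QP.toℚᵘ-fromℚᵘ (mkℚᵘ (Z.+ 1) m)) (ι≃k/1 (suc m))) cancel))
  where
  cancel : (mkℚᵘ (Z.+ 1) m U.* mkℚᵘ (Z.+ suc m) 0) U.≃ mkℚᵘ (Z.+ 1) 0
  cancel = *≡* (trans (ZP.*-identityʳ _) (trans (ZP.*-identityˡ (Z.+ suc m))
    (sym (trans (ZP.*-identityˡ _) (cong Z.+_ (NP.*-identityʳ (suc m)))))))

C-pos : ∀ a t → t ≤ a → 1 ≤ a C t
C-pos a       zero    _         = s≤s z≤n
C-pos (suc a) (suc t) (s≤s t≤a) = subst (1 ≤_) (nCk+nC[k+1]≡[n+1]C[k+1] a t)
  (NP.≤-trans (C-pos a t t≤a) (NP.m≤m+n (a C t) (a C suc t)))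

absorption : ∀ a t → suc t * (a C suc t) ≡ (a ∸ t) * (a C t)
absorption zero    t       = trans (NP.*-zeroʳ (suc t)) (sym (cong (_* (0 C t)) (NP.0∸n≡0 t)))
absorption (suc a) zero    = trans (NP.*-identityˡ _) (trans (nC1≡n (suc a)) (sym (NP.*-identityʳ (suc a))))
absorption (suc a) (suc t) = begin
  suc (suc t) * (suc a C suc (suc t))   ≡⟨ cong (suc (suc t) *_) (sym (nCk+nC[k+1]≡[n+1]C[k+1] a (suc t))) ⟩
  suc (suc t) * (X + Z)                 ≡⟨ NP.*-distribˡ-+ (suc (suc t)) X Z ⟩
  suc (suc t) * X + suc (suc t) * Z     ≡⟨ cong (suc (suc t) * X +_) (absorption a (suc t)) ⟩
  suc (suc t) * X + (a ∸ suc t) * X     ≡⟨ shift (suc t N.≤? a) ⟩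
  suc t * X + (a ∸ t) * X               ≡⟨ cong (_+ (a ∸ t) * X) (absorption a t) ⟩
  (a ∸ t) * Y + (a ∸ t) * X             ≡⟨ sym (NP.*-distribˡ-+ (a ∸ t) Y X) ⟩
  (a ∸ t) * (Y + X)                     ≡⟨ cong ((a ∸ t) *_) (nCk+nC[k+1]≡[n+1]C[k+1] a t) ⟩
  (a ∸ t) * (suc a C suc t)             ∎
  where
  X = a C suc t
  Y = a C t
  Z = a C suc (suc t)
  -- moving one copy of X across; if t + 1 > a then X = 0
  shift : Dec (suc t ≤ a) → suc (suc t) * X + (a ∸ suc t) * X ≡ suc t * X + (a ∸ t) * X
  shift (yes le) rewrite NP.+-∸-assoc 1 {a} {suc t} le =
    ℕS.solve 3 (λ t r x → (ℕS.con 2 ℕS.:+ t) ℕS.:* x ℕS.:+ r ℕS.:* x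
                       ℕS.:= (ℕS.con 1 ℕS.:+ t) ℕS.:* x ℕS.:+ (ℕS.con 1 ℕS.:+ r) ℕS.:* x)
      refl t (a ∸ suc t) X
  shift (no nle) rewrite k>n⇒nCk≡0 {a} {suc t} (NP.≰⇒> nle) =
    trans (cong₂ _+_ (NP.*-zeroʳ (suc (suc t))) (NP.*-zeroʳ (a ∸ suc t)))
          (sym (cong₂ _+_ (NP.*-zeroʳ (suc t)) (NP.*-zeroʳ (a ∸ t))))

ind : Bool → ℕ
ind b = if b then 1 else 0

ind-∧ : ∀ a b → ind (a ∧ b) ≡ ind a * ind b
ind-∧ true  b = sym (NP.+-identityʳ (ind b))
ind-∧ false b = refl

ind-injective : ∀ a b → ind a ≡ ind b → a ≡ b
ind-injective true  true  _ = refl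
ind-injective false false _ = refl

ind-not : ∀ b → ind (not b) + ind b ≡ 1
ind-not true  = refl
ind-not false = refl

sumFin-cong : ∀ {m} {f g : Fin m → ℕ} → (∀ i → f i ≡ g i) → sumFin f ≡ sumFin g
sumFin-cong {zero}  e = refl
sumFin-cong {suc m} e = cong₂ _+_ (e zero) (sumFin-cong (λ i → e (suc i)))

sumFin-+ : ∀ {m} (f g : Fin m → ℕ) → sumFin (λ i → f i + g i) ≡ sumFin f + sumFin g
sumFin-+ {zero}  f g = refl
sumFin-+ {suc m} f g = trans (cong (f zero + g zero +_) (sumFin-+ (λ i → f (suc i)) (λ i → g (suc i))))
  (ℕ-interchange (f zero) (g zero) (sumFin (λ i → f (suc i))) (sumFin (λ i → g (suc i))))

sumFin-const : ∀ {m} c → sumFin {m} (λ _ → c) ≡ m * c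
sumFin-const {zero}  c = refl
sumFin-const {suc m} c = cong (c +_) (sumFin-const {m} c)

sumFin-0 : ∀ {m} → sumFin {m} (λ _ → 0) ≡ 0
sumFin-0 {m} = trans (sumFin-const {m} 0) (NP.*-zeroʳ m)

sumFin-delta : ∀ {m} (a : Fin m) → sumFin (λ x → ind (does (x FP.≟ a))) ≡ 1
sumFin-delta {suc m} zero    = cong suc (sumFin-0 {m})
sumFin-delta {suc m} (suc a) = sumFin-delta a

sumFin-*ˡ : ∀ {m} k (f : Fin m → ℕ) → sumFin (λ i → k * f i) ≡ k * sumFin f
sumFin-*ˡ {zero}  k f = sym (NP.*-zeroʳ k)
sumFin-*ˡ {suc m} k f = trans (cong (k * f zero +_) (sumFin-*ˡ k (λ i → f (suc i))))
  (sym (NP.*-distribˡ-+ k (f zero) _))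

sumFin-*ʳ : ∀ {m} (f : Fin m → ℕ) k → sumFin (λ i → f i * k) ≡ sumFin f * k
sumFin-*ʳ f k = trans (sumFin-cong (λ i → NP.*-comm (f i) k))
  (trans (sumFin-*ˡ k f) (NP.*-comm k (sumFin f)))

sumFin-swap : ∀ {a b} (f : Fin a → Fin b → ℕ) →
  sumFin (λ i → sumFin (λ j → f i j)) ≡ sumFin (λ j → sumFin (λ i → f i j))
sumFin-swap {zero}  {b} f = sym (sumFin-0 {b})
sumFin-swap {suc a} {b} f = trans (cong (sumFin (f zero) +_) (sumFin-swap (λ i j → f (suc i) j)))
  (sym (sumFin-+ (f zero) (λ j → sumFin (λ i → f (suc i) j))))

sumFin-zero : ∀ {m} (f : Fin m → ℕ) → sumFin f ≡ 0 → ∀ i → f i ≡ 0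
sumFin-zero {suc m} f h zero    = NP.m+n≡0⇒m≡0 (f zero) h
sumFin-zero {suc m} f h (suc i) = sumFin-zero (λ i → f (suc i)) (NP.m+n≡0⇒n≡0 (f zero) h) i

sumFin-atMostOne : ∀ {m} (f : Fin m → Bool) → (∀ j l → f j ≡ true → f l ≡ true → j ≡ l) →
  sumFin (λ j → ind (f j)) ≡ ind (anyFin f)
sumFin-atMostOne {zero}  f h = refl
sumFin-atMostOne {suc m} f h with f zero in e
... | true  = cong suc (trans (sumFin-cong rest) (sumFin-0 {m}))
  where
  rest : ∀ j → ind (f (suc j)) ≡ 0
  rest j with f (suc j) in e′
  ... | true with () ← h zero (suc j) e e′
  ... | false = refl
... | false = sumFin-atMostOne (λ j → f (suc j)) (λ j l a b → FP.suc-injective (h (suc j) (suc l) a b))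

anyFin-false : ∀ {m} (f : Fin m → Bool) → anyFin f ≡ false → ∀ j → f j ≡ false
anyFin-false {suc m} f h zero    with f zero
... | false = refl
anyFin-false {suc m} f h (suc j) with f zero
... | false = anyFin-false (λ j → f (suc j)) h j

anyFin-false-intro : ∀ {m} (f : Fin m → Bool) → (∀ j → f j ≡ false) → anyFin f ≡ false
anyFin-false-intro {zero}  f h = refl
anyFin-false-intro {suc m} f h rewrite h zero = anyFin-false-intro (λ j → f (suc j)) (λ j → h (suc j))

allFinB : ∀ {m} → (Fin m → Bool) → Bool
allFinB {zero}  f = true
allFinB {suc m} f = f zero ∧ allFinB (λ i → f (suc i))

allFinB-intro : ∀ {m} (f : Fin m → Bool) → (∀ i → f i ≡ true) → allFinB f ≡ true
allFinB-intro {zero}  f h = refl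
allFinB-intro {suc m} f h rewrite h zero = allFinB-intro (λ i → f (suc i)) (λ i → h (suc i))

allFinB-elim : ∀ {m} (f : Fin m → Bool) → allFinB f ≡ true → ∀ i → f i ≡ true
allFinB-elim {suc m} f h i with f zero in e
allFinB-elim {suc m} f h zero    | true = e
allFinB-elim {suc m} f h (suc i) | true = allFinB-elim (λ i → f (suc i)) h i

sumL : ∀ {A : Set} → (A → ℕ) → List A → ℕ
sumL f []       = 0
sumL f (x ∷ xs) = f x + sumL f xs

countB : ∀ {A : Set} → (A → Bool) → List A → ℕ
countB p = sumL (λ x → ind (p x))

sumL-++ : ∀ {A : Set} (f : A → ℕ) xs ys → sumL f (xs ++ ys) ≡ sumL f xs + sumL f ys
sumL-++ f []       ys = refl
sumL-++ f (x ∷ xs) ys = trans (cong (f x +_) (sumL-++ f xs ys)) (sym (NP.+-assoc (f x) _ _))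

sumL-concatMap : ∀ {A B : Set} (f : B → ℕ) (h : A → List B) xs →
  sumL f (concatMap h xs) ≡ sumL (λ a → sumL f (h a)) xs
sumL-concatMap f h []       = refl
sumL-concatMap f h (x ∷ xs) = trans (sumL-++ f (h x) (concatMap h xs)) (cong (sumL f (h x) +_) (sumL-concatMap f h xs))

sumL-map : ∀ {A B : Set} (f : B → ℕ) (k : A → B) xs → sumL f (map k xs) ≡ sumL (λ x → f (k x)) xs
sumL-map f k []       = refl
sumL-map f k (x ∷ xs) = cong (f (k x) +_) (sumL-map f k xs)

sumL-All : ∀ {A : Set} {P : A → Set} {f g : A → ℕ} → (∀ x → P x → f x ≡ g x) →
  ∀ {xs} → All P xs → sumL f xs ≡ sumL g xs
sumL-All e []                    = refl
sumL-All e {x ∷ xs} (px ∷ ps) = cong₂ _+_ (e x px) (sumL-All e ps)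

sumL-cong : ∀ {A : Set} {f g : A → ℕ} → (∀ x → f x ≡ g x) → ∀ xs → sumL f xs ≡ sumL g xs
sumL-cong e []       = refl
sumL-cong e (x ∷ xs) = cong₂ _+_ (e x) (sumL-cong e xs)

sumL-*ˡ : ∀ {A : Set} k (f : A → ℕ) xs → sumL (λ x → k * f x) xs ≡ k * sumL f xs
sumL-*ˡ k f []       = sym (NP.*-zeroʳ k)
sumL-*ˡ k f (x ∷ xs) = trans (cong (k * f x +_) (sumL-*ˡ k f xs)) (sym (NP.*-distribˡ-+ k (f x) _))

sumL-sumFin : ∀ {A : Set} {m} (f : A → Fin m → ℕ) xs →
  sumL (λ x → sumFin (f x)) xs ≡ sumFin (λ i → sumL (λ x → f x i) xs)
sumL-sumFin {m = m} f []       = sym (sumFin-0 {m})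
sumL-sumFin         f (x ∷ xs) = trans (cong (sumFin (f x) +_) (sumL-sumFin f xs))
  (sym (sumFin-+ (f x) (λ i → sumL (λ x → f x i) xs)))

sumL-allFin : ∀ {m} (f : Fin m → ℕ) → sumL f (L.allFin m) ≡ sumFin f
sumL-allFin f = tab f (λ i → i)
  where
  tab : ∀ {A : Set} {m} (f : A → ℕ) (g : Fin m → A) → sumL f (L.tabulate g) ≡ sumFin (λ i → f (g i))
  tab {m = zero}  f g = refl
  tab {m = suc m} f g = cong (f (g zero) +_) (tab f (λ i → g (suc i)))

countB-false : ∀ {A : Set} (p : A → Bool) → (∀ x → p x ≡ false) → ∀ xs → countB p xs ≡ 0
countB-false p e []       = refl
countB-false p e (x ∷ xs) rewrite e x = countB-false p e xs

countB-∧ : ∀ {A : Set} (b : Bool) (q : A → Bool) xs → countB (λ x → b ∧ q x) xs ≡ ind b * countB q xs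
countB-∧ true  q xs = sym (NP.+-identityʳ _)
countB-∧ false q xs = countB-false (λ _ → false) (λ _ → refl) xs

countB-if : ∀ {A : Set} (p : A → Bool) b xs → countB p (if b then xs else []) ≡ ind b * countB p xs
countB-if p true  xs = sym (NP.+-identityʳ (countB p xs))
countB-if p false xs = refl

countB-filter : ∀ {A : Set} {P : A → Set} (P? : ∀ x → Dec (P x)) (q : A → Bool) xs →
  countB q (filter P? xs) ≡ countB (λ x → does (P? x) ∧ q x) xs
countB-filter P? q []       = refl
countB-filter P? q (x ∷ xs) with does (P? x)
... | true  = cong (ind (q x) +_) (countB-filter P? q xs)
... | false = countB-filter P? q xs

does-sound : ∀ {P : Set} (p : Dec P) → does p ≡ true → P
does-sound (yes x) _ = x

does-complete : ∀ {P : Set} (p : Dec P) → P → does p ≡ true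
does-complete (yes _) _ = refl
does-complete (no ¬x) x = ⊥-elim (¬x x)

does-false : ∀ {P : Set} (p : Dec P) → ¬ P → does p ≡ false
does-false (yes x) ¬x = ⊥-elim (¬x x)
does-false (no _)  _  = refl

does-reflects : ∀ {P : Set} (b : Bool) (p : Dec P) → (P → b ≡ true) → (b ≡ true → P) → does p ≡ b
does-reflects true  (yes _) f g = refl
does-reflects false (yes x) f g = sym (f x)
does-reflects true  (no ¬x) f g = ⊥-elim (¬x (g refl))
does-reflects false (no _)  f g = refl

does-iff : ∀ {P Q : Set} (p : Dec P) (q : Dec Q) → (P → Q) → (Q → P) → does p ≡ does q
does-iff p (yes y) f g = does-reflects true p (λ _ → refl) (λ _ → g y)
does-iff p (no ¬y) f g = does-reflects false p (λ x → ⊥-elim (¬y (f x))) (λ ())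

bool-iff : ∀ {a b : Bool} → (a ≡ true → b ≡ true) → (b ≡ true → a ≡ true) → a ≡ b
bool-iff {true}  {true}  f g = refl
bool-iff {true}  {false} f g = sym (f refl)
bool-iff {false} {true}  f g = g refl
bool-iff {false} {false} f g = refl

∧-true : ∀ {a b} → a ∧ b ≡ true → a ≡ true × b ≡ true
∧-true {true} h = refl , h

∧-intro : ∀ {a b} → a ≡ true → b ≡ true → a ∧ b ≡ true
∧-intro refl refl = refl

not-true : ∀ b → not b ≡ true → b ≡ false
not-true false _ = refl

t≢f : true ≡ false → ⊥
t≢f ()

-- Coefficients of polynomials.  A term (c , μ) contributes c · δ μ m to the
-- coefficient of m; everything below is computed through this formula.

module _ {n : ℕ} where

  δ : Mono n → Mono n → ℚ
  δ μ m = ι (ind (does (μ ≟ₘ m)))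

  coeff-∷ : ∀ c μ (p : Poly n) m → coeff ((c , μ) ∷ p) m ≡ c *q δ μ m +q coeff p m
  coeff-∷ c μ p m = split (μ ≟ₘ m)
    where
    -- coeff computes with its own copy of the decision μ ≟ₘ m
    split : (D : Dec (∀ i j → μ i j ≡ m i j)) → coeff ((c , μ) ∷ p) m ≡ c *q ι (ind (does D)) +q coeff p m
    split D with μ ≟ₘ m
    split (yes _) | yes _ = cong (_+q coeff p m) (sym (trans (cong (c *q_) (QP.+-identityʳ 1ℚ)) (QP.*-identityʳ c)))
    split (no ¬e) | yes e = ⊥-elim (¬e e)
    split (yes e) | no ¬e = ⊥-elim (¬e e)
    split (no _)  | no _  = sym (trans (cong (_+q coeff p m) (QP.*-zeroʳ c)) (QP.+-identityˡ _))

  δ-cong : ∀ (μ ν m : Mono n) → (∀ i j → μ i j ≡ ν i j) → δ μ m ≡ δ ν m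
  δ-cong μ ν m e = cong (λ b → ι (ind b)) (does-iff (μ ≟ₘ m) (ν ≟ₘ m)
    (λ h i j → trans (sym (e i j)) (h i j)) (λ h i j → trans (e i j) (h i j)))

  δ-cancel : ∀ a b (μ m : Mono n) → a +q b ≡ 0ℚ → a *q δ μ m +q b *q δ μ m ≡ 0ℚ
  δ-cancel a b μ m e = trans (sym (QP.*-distribʳ-+ (δ μ m) a b))
    (trans (cong (_*q δ μ m) e) (QP.*-zeroˡ (δ μ m)))

  coeff-++ : ∀ (p q : Poly n) m → coeff (p ++ q) m ≡ coeff p m +q coeff q m
  coeff-++ []            q m = sym (QP.+-identityˡ _)
  coeff-++ ((c , μ) ∷ p) q m = begin
    coeff ((c , μ) ∷ (p ++ q)) m                 ≡⟨ coeff-∷ c μ (p ++ q) m ⟩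
    c *q δ μ m +q coeff (p ++ q) m               ≡⟨ cong (c *q δ μ m +q_) (coeff-++ p q m) ⟩
    c *q δ μ m +q (coeff p m +q coeff q m)       ≡⟨ sym (QP.+-assoc (c *q δ μ m) _ _) ⟩
    (c *q δ μ m +q coeff p m) +q coeff q m       ≡⟨ cong (_+q coeff q m) (sym (coeff-∷ c μ p m)) ⟩
    coeff ((c , μ) ∷ p) m +q coeff q m           ∎

  coeff-concatMap-++ : ∀ {A : Set} (f : A → Poly n) xs ys m →
    coeff (concatMap f (xs ++ ys)) m ≡ coeff (concatMap f xs) m +q coeff (concatMap f ys) m
  coeff-concatMap-++ f xs ys m =
    trans (cong (λ p → coeff p m) (LP.concatMap-++ f xs ys)) (coeff-++ (concatMap f xs) _ m)

  scale : ℚ → Poly n → Poly n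
  scale c []            = []
  scale c ((a , μ) ∷ p) = (c *q a , μ) ∷ scale c p

  coeff-scale : ∀ c (p : Poly n) m → coeff (scale c p) m ≡ c *q coeff p m
  coeff-scale c []            m = sym (QP.*-zeroʳ c)
  coeff-scale c ((a , μ) ∷ p) m = begin
    coeff ((c *q a , μ) ∷ scale c p) m           ≡⟨ coeff-∷ (c *q a) μ (scale c p) m ⟩
    c *q a *q δ μ m +q coeff (scale c p) m       ≡⟨ cong₂ _+q_ (QP.*-assoc c a (δ μ m)) (coeff-scale c p m) ⟩
    c *q (a *q δ μ m) +q c *q coeff p m          ≡⟨ sym (QP.*-distribˡ-+ c _ _) ⟩
    c *q (a *q δ μ m +q coeff p m)               ≡⟨ cong (c *q_) (sym (coeff-∷ a μ p m)) ⟩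
    c *q coeff ((a , μ) ∷ p) m                   ∎

  scale-++ : ∀ c (p q : Poly n) → scale c (p ++ q) ≡ scale c p ++ scale c q
  scale-++ c []      q = refl
  scale-++ c (t ∷ p) q = cong (_ ∷_) (scale-++ c p q)

  scale-*ₚ : ∀ c (q r : Poly n) → scale c q *ₚ r ≡ scale c (q *ₚ r)
  scale-*ₚ c []            r = refl
  scale-*ₚ c ((a , μ) ∷ q) r =
    trans (cong₂ _++_ (row r) (scale-*ₚ c q r)) (sym (scale-++ c (map (times a) r) (q *ₚ r)))
    where
    times : ℚ → ℚ × Mono n → ℚ × Mono n
    times a = λ { (b , ν) → a *q b , (λ i j → μ i j + ν i j) }
    row : ∀ r → map (times (c *q a)) r ≡ scale c (map (times a) r)
    row []            = refl
    row ((b , ν) ∷ r) = cong₂ _∷_ (cong (_, _) (QP.*-assoc c a b)) (row r)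

  scale-∘ : ∀ a b (p : Poly n) → scale a (scale b p) ≈ₚ scale (a *q b) p
  scale-∘ a b p m = begin
    coeff (scale a (scale b p)) m   ≡⟨ coeff-scale a (scale b p) m ⟩
    a *q coeff (scale b p) m        ≡⟨ cong (a *q_) (coeff-scale b p m) ⟩
    a *q (b *q coeff p m)           ≡⟨ sym (QP.*-assoc a b (coeff p m)) ⟩
    (a *q b) *q coeff p m           ≡⟨ sym (coeff-scale (a *q b) p m) ⟩
    coeff (scale (a *q b) p) m      ∎

  scale-ι-∘ : ∀ a b (p : Poly n) → scale (ι a) (scale (ι b) p) ≈ₚ scale (ι (a * b)) p
  scale-ι-∘ a b p m = trans (scale-∘ (ι a) (ι b) p m) (cong (λ c → coeff (scale c p) m) (sym (ι-* a b)))

  scale-1 : ∀ (p : Poly n) → scale 1ℚ p ≈ₚ p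
  scale-1 p m = trans (coeff-scale 1ℚ p m) (QP.*-identityˡ (coeff p m))

  scale-cong : ∀ {a b} (p : Poly n) → a ≡ b → scale a p ≈ₚ scale b p
  scale-cong p refl m = refl

  degLE-scale : ∀ c (p : Poly n) d → DegLE p d → DegLE (scale c p) d
  degLE-scale c p d h m nz =
    h m (λ z → nz (trans (coeff-scale c p m) (trans (cong (c *q_) z) (QP.*-zeroʳ c))))

  totalDeg-cong : ∀ (μ ν : Mono n) → (∀ i j → μ i j ≡ ν i j) → totalDeg μ ≡ totalDeg ν
  totalDeg-cong μ ν e = sumFin-cong (λ i → sumFin-cong (λ j → e i j))

  totalDeg-+ : ∀ (μ ν : Mono n) → totalDeg (λ i j → μ i j + ν i j) ≡ totalDeg μ + totalDeg ν
  totalDeg-+ μ ν = trans (sumFin-cong (λ i → sumFin-+ (μ i) (ν i))) (sumFin-+ (λ i → sumFin (μ i)) (λ i → sumFin (ν i)))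

  degLE-terms : ∀ (p : Poly n) d → All (λ t → totalDeg (proj₂ t) ≤ d) p → DegLE p d
  degLE-terms []            d []       m nz = ⊥-elim (nz refl)
  degLE-terms ((c , μ) ∷ p) d (h ∷ hs) m nz with μ ≟ₘ m
  ... | yes e = subst (_≤ d) (totalDeg-cong μ m e) h
  ... | no  _ = degLE-terms p d hs m nz

-- F ⇝[ d ] G wraps Derives n d F G in a record, so that the end
-- points F and G become inferable indices; the closure properties below say
-- that ≡_{(𝒬_n, d)} is a congruence for sums and scalars, transitive, and
-- coarser than equality of polynomials.

module _ {n : ℕ} where

  infix 4 _⇝[_]_
  record _⇝[_]_ (F : Poly n) (d : ℕ) (G : Poly n) : Set where
    constructor derivation
    field derives : Derives n d F G
  open _⇝[_]_ public

  added : List (Axiom n × Poly n) → Poly n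
  added = concatMap (λ { (a , q) → q *ₚ axPoly a })

  ≈⇒⇝ : ∀ {d} {F G : Poly n} → F ≈ₚ G → F ⇝[ d ] G
  ≈⇒⇝ {F = F} e = derivation ([] , [] , λ m → trans (coeff-++ F [] m) (trans (QP.+-identityʳ _) (e m)))

  ⇝-refl : ∀ {d} {F : Poly n} → F ⇝[ d ] F
  ⇝-refl = ≈⇒⇝ (λ _ → refl)

  ⇝-trans : ∀ {d} {F G H : Poly n} → F ⇝[ d ] G → G ⇝[ d ] H → F ⇝[ d ] H
  ⇝-trans {F = F} {G} {H} (derivation (L₁ , deg₁ , e₁)) (derivation (L₂ , deg₂ , e₂)) =
    derivation (L₁ ++ L₂ , AllP.++⁺ deg₁ deg₂ , eq)
    where
    eq : (F ++ added (L₁ ++ L₂)) ≈ₚ H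
    eq m = begin
      coeff (F ++ added (L₁ ++ L₂)) m            ≡⟨ coeff-++ F _ m ⟩
      coeff F m +q coeff (added (L₁ ++ L₂)) m    ≡⟨ cong (coeff F m +q_) (coeff-concatMap-++ _ L₁ L₂ m) ⟩
      coeff F m +q (c₁ +q c₂)                    ≡⟨ sym (QP.+-assoc (coeff F m) c₁ c₂) ⟩
      (coeff F m +q c₁) +q c₂                    ≡⟨ cong (_+q c₂) (trans (sym (coeff-++ F _ m)) (e₁ m)) ⟩
      coeff G m +q c₂                            ≡⟨ trans (sym (coeff-++ G _ m)) (e₂ m) ⟩
      coeff H m                                  ∎
      where
      c₁ = coeff (added L₁) m
      c₂ = coeff (added L₂) m

  ⇝-++ : ∀ {d} {F F′ G G′ : Poly n} → F ⇝[ d ] G → F′ ⇝[ d ] G′ → (F ++ F′) ⇝[ d ] (G ++ G′)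
  ⇝-++ {F = F} {F′} {G} {G′} (derivation (L₁ , deg₁ , e₁)) (derivation (L₂ , deg₂ , e₂)) =
    derivation (L₁ ++ L₂ , AllP.++⁺ deg₁ deg₂ , eq)
    where
    eq : ((F ++ F′) ++ added (L₁ ++ L₂)) ≈ₚ (G ++ G′)
    eq m = begin
      coeff ((F ++ F′) ++ added (L₁ ++ L₂)) m       ≡⟨ coeff-++ (F ++ F′) _ m ⟩
      coeff (F ++ F′) m +q coeff (added (L₁ ++ L₂)) m ≡⟨ cong₂ _+q_ (coeff-++ F F′ m) (coeff-concatMap-++ _ L₁ L₂ m) ⟩
      (a +q b) +q (c₁ +q c₂)                        ≡⟨ solve 4 (λ a b c₁ c₂ → (a :+ b) :+ (c₁ :+ c₂) := (a :+ c₁) :+ (b :+ c₂)) refl a b c₁ c₂ ⟩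
      (a +q c₁) +q (b +q c₂)                        ≡⟨ cong₂ _+q_ (trans (sym (coeff-++ F _ m)) (e₁ m)) (trans (sym (coeff-++ F′ _ m)) (e₂ m)) ⟩
      coeff G m +q coeff G′ m                       ≡⟨ sym (coeff-++ G G′ m) ⟩
      coeff (G ++ G′) m                             ∎
      where
      a  = coeff F m
      b  = coeff F′ m
      c₁ = coeff (added L₁) m
      c₂ = coeff (added L₂) m

  ⇝-weaken : ∀ {d d′} {F G : Poly n} → d ≤ d′ → F ⇝[ d ] G → F ⇝[ d′ ] G
  ⇝-weaken d≤d′ (derivation (L , deg , e)) =
    derivation (L , All.map (λ h m nz → NP.≤-trans (h m nz) d≤d′) deg , e)

  ⇝-scale : ∀ {d} c {F G : Poly n} → F ⇝[ d ] G → scale c F ⇝[ d ] scale c G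
  ⇝-scale {d} c {F} {G} (derivation (L , deg , e)) = derivation (scaleL L , degs L deg , eq)
    where
    scaleL : List (Axiom n × Poly n) → List (Axiom n × Poly n)
    scaleL []            = []
    scaleL ((a , q) ∷ L) = (a , scale c q) ∷ scaleL L
    added-scale : ∀ L → added (scaleL L) ≡ scale c (added L)
    added-scale []            = refl
    added-scale ((a , q) ∷ L) = trans (cong₂ _++_ (scale-*ₚ c q (axPoly a)) (added-scale L))
      (sym (scale-++ c (q *ₚ axPoly a) (added L)))
    degs : ∀ L → All (λ { (a , q) → DegLE (q *ₚ axPoly a) d }) L →
           All (λ { (a , q) → DegLE (q *ₚ axPoly a) d }) (scaleL L)
    degs []            []       = []
    degs ((a , q) ∷ L) (h ∷ hs) =
      subst (λ p → DegLE p d) (sym (scale-*ₚ c q (axPoly a))) (degLE-scale c (q *ₚ axPoly a) d h) ∷ degs L hs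
    eq : (scale c F ++ added (scaleL L)) ≈ₚ scale c G
    eq m = begin
      coeff (scale c F ++ added (scaleL L)) m     ≡⟨ cong (λ p → coeff (scale c F ++ p) m) (added-scale L) ⟩
      coeff (scale c F ++ scale c (added L)) m    ≡⟨ cong (λ p → coeff p m) (sym (scale-++ c F (added L))) ⟩
      coeff (scale c (F ++ added L)) m            ≡⟨ coeff-scale c (F ++ added L) m ⟩
      c *q coeff (F ++ added L) m                 ≡⟨ cong (c *q_) (e m) ⟩
      c *q coeff G m                              ≡⟨ sym (coeff-scale c G m) ⟩
      coeff (scale c G) m                         ∎

  infixr 2 _≈⟨_⟩_ _≈˘⟨_⟩_ _⇝⟨_⟩_
  infix  3 _∎ₚ

  _≈⟨_⟩_ : ∀ {d} (F : Poly n) {G H : Poly n} → F ≈ₚ G → G ⇝[ d ] H → F ⇝[ d ] H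
  F ≈⟨ e ⟩ D = ⇝-trans (≈⇒⇝ e) D

  _≈˘⟨_⟩_ : ∀ {d} (F : Poly n) {G H : Poly n} → G ≈ₚ F → G ⇝[ d ] H → F ⇝[ d ] H
  F ≈˘⟨ e ⟩ D = ⇝-trans (≈⇒⇝ (λ m → sym (e m))) D

  _⇝⟨_⟩_ : ∀ {d} (F : Poly n) {G H : Poly n} → F ⇝[ d ] G → G ⇝[ d ] H → F ⇝[ d ] H
  F ⇝⟨ D ⟩ D′ = ⇝-trans D D′

  _∎ₚ : ∀ {d} (F : Poly n) → F ⇝[ d ] F
  F ∎ₚ = ⇝-refl

  scale-inverse : ∀ c (p : Poly n) → scale (invℕ (suc c)) (scale (ι (suc c)) p) ≈ₚ p
  scale-inverse c p m = begin
    coeff (scale (invℕ (suc c)) (scale (ι (suc c)) p)) m   ≡⟨ scale-∘ (invℕ (suc c)) (ι (suc c)) p m ⟩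
    coeff (scale (invℕ (suc c) *q ι (suc c)) p) m          ≡⟨ scale-cong p (invℕ-inverse c) m ⟩
    coeff (scale 1ℚ p) m                                   ≡⟨ scale-1 p m ⟩
    coeff p m                                              ∎

  ⇝-divide : ∀ {d} c {F G : Poly n} → 1 ≤ c → scale (ι c) F ⇝[ d ] G → F ⇝[ d ] scale (invℕ c) G
  ⇝-divide (suc c) {F} {G} _ D =
    F                                           ≈˘⟨ scale-inverse c F ⟩
    scale (invℕ (suc c)) (scale (ι (suc c)) F)  ⇝⟨ ⇝-scale (invℕ (suc c)) D ⟩
    scale (invℕ (suc c)) G                      ∎ₚ

allFuns-unique : ∀ {A : Set} (R : A → A → Bool) (xs : List A) → (∀ a → countB (λ x → R x a) xs ≡ 1) →
  ∀ m (g : Fin m → A) → countB (λ f → allFinB (λ i → R (f i) (g i))) (allFuns m xs) ≡ 1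
allFuns-unique R xs h zero    g = refl
allFuns-unique R xs h (suc m) g = begin
  countB matches (allFuns (suc m) xs)                                 ≡⟨ sumL-concatMap _ _ xs ⟩
  sumL (λ a → countB matches (map _ (allFuns m xs))) xs               ≡⟨ sumL-cong headTail xs ⟩
  sumL (λ a → ind (R a (g zero)) * 1) xs                              ≡⟨ sumL-cong (λ a → NP.*-identityʳ _) xs ⟩
  countB (λ a → R a (g zero)) xs                                      ≡⟨ h (g zero) ⟩
  1                                                                   ∎
  where
  matches : (Fin (suc m) → _) → Bool
  matches f = allFinB (λ i → R (f i) (g i))
  -- the head must match g zero, and the tail matches g ∘ suc exactly once
  headTail : ∀ a → countB matches (map _ (allFuns m xs)) ≡ ind (R a (g zero)) * 1
  headTail a = trans (sumL-map _ _ (allFuns m xs)) (trans (countB-∧ (R a (g zero)) _ (allFuns m xs))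
    (cong (ind (R a (g zero)) *_) (allFuns-unique R xs h m (λ i → g (suc i)))))

module _ {n : ℕ} where

  _≅_ : EdgeSet n → EdgeSet n → Set
  X ≅ Y = ∀ i j → X i j ≡ Y i j

  ≅-sym : {X Y : EdgeSet n} → X ≅ Y → Y ≅ X
  ≅-sym e i j = sym (e i j)

  eqB : EdgeSet n → EdgeSet n → Bool
  eqB X Y = allFinB (λ i → allFinB (λ j → does (X i j BP.≟ Y i j)))

  eqB-sound : ∀ X Y → eqB X Y ≡ true → X ≅ Y
  eqB-sound X Y h i j = does-sound (X i j BP.≟ Y i j) (allFinB-elim _ (allFinB-elim _ h i) j)

  eqB-complete : ∀ X Y → X ≅ Y → eqB X Y ≡ true
  eqB-complete X Y e = allFinB-intro _ (λ i → allFinB-intro _ (λ j → does-complete (X i j BP.≟ Y i j) (e i j)))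

  IsMatching-≅ : ∀ {X Y : EdgeSet n} → X ≅ Y → IsMatching X → IsMatching Y
  IsMatching-≅ e (r , c) = (λ i j l a b → r i j l (trans (e i j) a) (trans (e i l) b))
                         , (λ i l j a b → c i l j (trans (e i j) a) (trans (e l j) b))

  edgeCount-≅ : ∀ {X Y : EdgeSet n} → X ≅ Y → edgeCount X ≡ edgeCount Y
  edgeCount-≅ e = sumFin-cong (λ i → sumFin-cong (λ j → cong ind (e i j)))

  mult : List (EdgeSet n) → EdgeSet n → ℕ
  mult Xs G = countB (λ X → eqB X G) Xs

  mult-allEdgeSets : ∀ G → mult (allEdgeSets n) G ≡ 1
  mult-allEdgeSets G = allFuns-unique (λ r r′ → allFinB (λ j → does (r j BP.≟ r′ j)))
    (allFuns n (true ∷ false ∷ []))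
    (λ row → allFuns-unique (λ x y → does (x BP.≟ y)) (true ∷ false ∷ []) oneBool n row) n G
    where
    oneBool : ∀ b → countB (λ x → does (x BP.≟ b)) (true ∷ false ∷ []) ≡ 1
    oneBool true  = refl
    oneBool false = refl

  mult-filter : ∀ {P : EdgeSet n → Set} (P? : ∀ X → Dec (P X)) → (∀ {X Y} → X ≅ Y → P X → P Y) →
    ∀ G → mult (filter P? (allEdgeSets n)) G ≡ ind (does (P? G))
  mult-filter P? P-≅ G = begin
    mult (filter P? (allEdgeSets n)) G                     ≡⟨ countB-filter P? (λ X → eqB X G) (allEdgeSets n) ⟩
    countB (λ X → does (P? X) ∧ eqB X G) (allEdgeSets n)   ≡⟨ sumL-cong (λ X → cong ind (onlyG X)) (allEdgeSets n) ⟩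
    countB (λ X → does (P? G) ∧ eqB X G) (allEdgeSets n)   ≡⟨ countB-∧ (does (P? G)) (λ X → eqB X G) (allEdgeSets n) ⟩
    ind (does (P? G)) * mult (allEdgeSets n) G             ≡⟨ cong (ind (does (P? G)) *_) (mult-allEdgeSets G) ⟩
    ind (does (P? G)) * 1                                  ≡⟨ NP.*-identityʳ _ ⟩
    ind (does (P? G))                                      ∎
    where
    onlyG : ∀ X → does (P? X) ∧ eqB X G ≡ does (P? G) ∧ eqB X G
    onlyG X with eqB X G in e
    ... | true  = trans (BP.∧-identityʳ _) (trans (does-iff (P? X) (P? G) (P-≅ (eqB-sound X G e))
                    (P-≅ (≅-sym (eqB-sound X G e)))) (sym (BP.∧-identityʳ _)))
    ... | false = trans (BP.∧-zeroʳ _) (sym (BP.∧-zeroʳ _))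

  weighted : ℚ → List (EdgeSet n) → Poly n
  weighted c = map (λ X → (c , monoOf X))

  emb : List (EdgeSet n) → Poly n
  emb = weighted 1ℚ

  monoCount : List (EdgeSet n) → Mono n → ℕ
  monoCount Xs m = countB (λ X → does (monoOf X ≟ₘ m)) Xs

  coeff-weighted : ∀ c Xs m → coeff (weighted c Xs) m ≡ c *q ι (monoCount Xs m)
  coeff-weighted c []       m = sym (QP.*-zeroʳ c)
  coeff-weighted c (X ∷ Xs) m = begin
    coeff ((c , monoOf X) ∷ weighted c Xs) m     ≡⟨ coeff-∷ c (monoOf X) (weighted c Xs) m ⟩
    c *q ι b +q coeff (weighted c Xs) m          ≡⟨ cong (c *q ι b +q_) (coeff-weighted c Xs m) ⟩
    c *q ι b +q c *q ι r                         ≡⟨ sym (QP.*-distribˡ-+ c (ι b) (ι r)) ⟩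
    c *q (ι b +q ι r)                            ≡⟨ cong (c *q_) (sym (ι-+ b r)) ⟩
    c *q ι (b + r)                               ∎
    where
    b = ind (does (monoOf X ≟ₘ m))
    r = monoCount Xs m

  toEdges : Mono n → EdgeSet n
  toEdges m i j = does (m i j N.≟ 1)

  SquareFree : Mono n → Set
  SquareFree m = ∀ i j → m i j ≡ monoOf (toEdges m) i j

  monoOf-squareFree : ∀ X (m : Mono n) → (∀ i j → monoOf X i j ≡ m i j) → SquareFree m
  monoOf-squareFree X m e i j with X i j | e i j
  ... | true  | p rewrite sym p = refl
  ... | false | p rewrite sym p = refl

  monoOf≟-eqB : ∀ X G → does (monoOf X ≟ₘ monoOf G) ≡ eqB X G
  monoOf≟-eqB X G = does-reflects (eqB X G) (monoOf X ≟ₘ monoOf G)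
    (λ e → eqB-complete X G (λ i j → ind-injective (X i j) (G i j) (e i j)))
    (λ e i j → cong ind (eqB-sound X G e i j))

  monoCount-squareFree : ∀ m → SquareFree m → ∀ Xs → monoCount Xs m ≡ mult Xs (toEdges m)
  monoCount-squareFree m sf = sumL-cong (λ X → cong ind (trans
    (does-iff (monoOf X ≟ₘ m) (monoOf X ≟ₘ monoOf (toEdges m))
      (λ e i j → trans (e i j) (sf i j)) (λ e i j → trans (e i j) (sym (sf i j))))
    (monoOf≟-eqB X (toEdges m))))

  monoCount-notSquareFree : ∀ m → ¬ SquareFree m → ∀ Xs → monoCount Xs m ≡ 0
  monoCount-notSquareFree m nsf = countB-false _
    (λ X → does-false (monoOf X ≟ₘ m) (λ e → nsf (monoOf-squareFree X m e)))

  emb-proportional : ∀ c (Xs Ys : List (EdgeSet n)) → (∀ G → mult Xs G ≡ c * mult Ys G) →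
    emb Xs ≈ₚ scale (ι c) (emb Ys)
  emb-proportional c Xs Ys h m = begin
    coeff (emb Xs) m                     ≡⟨ trans (coeff-weighted 1ℚ Xs m) (QP.*-identityˡ _) ⟩
    ι (monoCount Xs m)                   ≡⟨ cong ι (counts (m ≟ₘ monoOf (toEdges m))) ⟩
    ι (c * monoCount Ys m)               ≡⟨ ι-* c (monoCount Ys m) ⟩
    ι c *q ι (monoCount Ys m)            ≡⟨ cong (ι c *q_) (sym (trans (coeff-weighted 1ℚ Ys m) (QP.*-identityˡ _))) ⟩
    ι c *q coeff (emb Ys) m              ≡⟨ sym (coeff-scale (ι c) (emb Ys) m) ⟩
    coeff (scale (ι c) (emb Ys)) m       ∎
    where
    counts : Dec (SquareFree m) → monoCount Xs m ≡ c * monoCount Ys m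
    counts (yes sf)  = trans (monoCount-squareFree m sf Xs)
      (trans (h (toEdges m)) (cong (c *_) (sym (monoCount-squareFree m sf Ys))))
    counts (no nsf) = trans (monoCount-notSquareFree m nsf Xs)
      (sym (trans (cong (c *_) (monoCount-notSquareFree m nsf Ys)) (NP.*-zeroʳ c)))

  emb-++ : ∀ (Xs Ys : List (EdgeSet n)) → emb (Xs ++ Ys) ≡ emb Xs ++ emb Ys
  emb-++ Xs Ys = LP.map-++ (λ X → (1ℚ , monoOf X)) Xs Ys

  scale-emb : ∀ c Xs → scale c (emb Xs) ≈ₚ weighted c Xs
  scale-emb c Xs m = begin
    coeff (scale c (emb Xs)) m          ≡⟨ coeff-scale c (emb Xs) m ⟩
    c *q coeff (emb Xs) m               ≡⟨ cong (c *q_) (coeff-weighted 1ℚ Xs m) ⟩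
    c *q (1ℚ *q ι (monoCount Xs m))     ≡⟨ cong (c *q_) (QP.*-identityˡ _) ⟩
    c *q ι (monoCount Xs m)             ≡⟨ sym (coeff-weighted c Xs m) ⟩
    coeff (weighted c Xs) m             ∎

  ⇝-concatMap : ∀ {d} {A : Set} (f g : A → List (EdgeSet n)) {xs : List A} →
    All (λ x → emb (f x) ⇝[ d ] emb (g x)) xs → emb (concatMap f xs) ⇝[ d ] emb (concatMap g xs)
  ⇝-concatMap f g []                 = ⇝-refl
  ⇝-concatMap {d} f g {x ∷ xs} (D ∷ Ds) =
    subst₂ (λ F G → F ⇝[ d ] G) (sym (emb-++ (f x) _)) (sym (emb-++ (g x) _)) (⇝-++ D (⇝-concatMap f g Ds))
    where open Eq using (subst₂)

module _ {n : ℕ} where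

  at : Fin n → Fin n → Fin n → Fin n → Bool
  at i j a b = does (a FP.≟ i) ∧ does (b FP.≟ j)

  unitMono : Fin n → Fin n → Mono n
  unitMono i j a b = ind (at i j a b)

  at-self : ∀ i j → at i j i j ≡ true
  at-self i j = ∧-intro (does-complete (i FP.≟ i) refl) (does-complete (j FP.≟ j) refl)

  at-or-off : ∀ a b i j → (a ≡ i × b ≡ j) ⊎ (at i j a b ≡ false)
  at-or-off a b i j with a FP.≟ i | b FP.≟ j
  ... | yes p | yes q = inj₁ (p , q)
  ... | yes _ | no _  = inj₂ refl
  ... | no _  | _     = inj₂ refl

  totalDeg-unitMono : ∀ i j → totalDeg (unitMono i j) ≡ 1
  totalDeg-unitMono i j = trans (sumFin-cong row) (sumFin-delta i)
    where
    row : ∀ a → sumFin (λ b → unitMono i j a b) ≡ ind (does (a FP.≟ i))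
    row a with does (a FP.≟ i)
    ... | true  = sumFin-delta j
    ... | false = sumFin-0 {n}

  addE : EdgeSet n → Fin n → Fin n → EdgeSet n
  addE E i j a b = E a b ∨ at i j a b

  delE : EdgeSet n → Fin n → Fin n → EdgeSet n
  delE G i j a b = G a b ∧ not (at i j a b)

  addE-at : ∀ (E : EdgeSet n) i j → addE E i j i j ≡ true
  addE-at E i j = trans (cong (E i j ∨_) (at-self i j)) (BP.∨-zeroʳ (E i j))

  addE-off : ∀ (E : EdgeSet n) i j a b → at i j a b ≡ false → addE E i j a b ≡ E a b
  addE-off E i j a b off = trans (cong (E a b ∨_) off) (BP.∨-identityʳ (E a b))

  delE-at : ∀ (G : EdgeSet n) i j → delE G i j i j ≡ false
  delE-at G i j = trans (cong (λ z → G i j ∧ not z) (at-self i j)) (BP.∧-zeroʳ (G i j))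

  delE-off : ∀ (G : EdgeSet n) i j a b → at i j a b ≡ false → delE G i j a b ≡ G a b
  delE-off G i j a b off = trans (cong (λ z → G a b ∧ not z) off) (BP.∧-identityʳ (G a b))

  add-del : ∀ (G : EdgeSet n) i j → G i j ≡ true → addE (delE G i j) i j ≅ G
  add-del G i j g a b with at-or-off a b i j
  ... | inj₁ (refl , refl) = trans (addE-at (delE G i j) i j) (sym g)
  ... | inj₂ off           = trans (addE-off (delE G i j) i j a b off) (delE-off G i j a b off)

  monoOf-addE : ∀ (E : EdgeSet n) i j → E i j ≡ false →
    ∀ a b → monoOf E a b + unitMono i j a b ≡ monoOf (addE E i j) a b
  monoOf-addE E i j new a b with at-or-off a b i j
  ... | inj₁ (refl , refl) rewrite new | at-self i j = refl
  ... | inj₂ off rewrite off | BP.∨-identityʳ (E a b) = NP.+-identityʳ _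

  edgeCount-addE : ∀ (E : EdgeSet n) i j → E i j ≡ false → edgeCount (addE E i j) ≡ suc (edgeCount E)
  edgeCount-addE E i j new = begin
    totalDeg (monoOf (addE E i j))                     ≡⟨ sym (totalDeg-cong _ _ (monoOf-addE E i j new)) ⟩
    totalDeg (λ a b → monoOf E a b + unitMono i j a b) ≡⟨ totalDeg-+ (monoOf E) (unitMono i j) ⟩
    edgeCount E + totalDeg (unitMono i j)              ≡⟨ cong (edgeCount E +_) (totalDeg-unitMono i j) ⟩
    edgeCount E + 1                                    ≡⟨ NP.+-comm (edgeCount E) 1 ⟩
    suc (edgeCount E)                                  ∎

  edgeCount-delE : ∀ (G : EdgeSet n) i j → G i j ≡ true → edgeCount G ≡ suc (edgeCount (delE G i j))
  edgeCount-delE G i j g = trans (edgeCount-≅ (≅-sym (add-del G i j g)))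
    (edgeCount-addE (delE G i j) i j (delE-at G i j))

  delE-matching : ∀ (G : EdgeSet n) i j → IsMatching G → IsMatching (delE G i j)
  delE-matching G i j (r , c) = (λ a b l x y → r a b l (proj₁ (∧-true x)) (proj₁ (∧-true y)))
                              , (λ a l b x y → c a l b (proj₁ (∧-true x)) (proj₁ (∧-true y)))

  freeRow : EdgeSet n → Fin n → Bool
  freeRow E i = not (anyFin (λ j → E i j))

  freeRow-sound : ∀ (E : EdgeSet n) i → freeRow E i ≡ true → ∀ j → E i j ≡ false
  freeRow-sound E i fr = anyFin-false (λ j → E i j) (not-true _ fr)

  -- In a matching, every edge occupies its own row and its own column.
  edgeCount-rows : ∀ (X : EdgeSet n) → IsMatching X → edgeCount X ≡ sumFin (λ i → ind (anyFin (λ j → X i j)))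
  edgeCount-rows X (r , c) = sumFin-cong (λ i → sumFin-atMostOne (λ j → X i j) (r i))

  edgeCount-cols : ∀ (X : EdgeSet n) → IsMatching X → edgeCount X ≡ sumFin (λ j → ind (anyFin (λ i → X i j)))
  edgeCount-cols X (r , c) = trans (sumFin-swap (λ i j → ind (X i j)))
    (sumFin-cong (λ j → sumFin-atMostOne (λ i → X i j) (λ i l a b → c i l j a b)))

  coveredCount-matching : ∀ (X : EdgeSet n) → IsMatching X → coveredCount X ≡ 2 * edgeCount X
  coveredCount-matching X mX = trans (cong₂ _+_ (sym (edgeCount-rows X mX)) (sym (edgeCount-cols X mX)))
    (cong (edgeCount X +_) (sym (NP.+-identityʳ _)))

  freeRows-count : ∀ (E : EdgeSet n) → IsMatching E → sumFin (λ i → ind (freeRow E i)) ≡ n ∸ edgeCount E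
  freeRows-count E mE = begin
    free                                                         ≡⟨ sym (NP.m+n∸n≡m free (edgeCount E)) ⟩
    (free + edgeCount E) ∸ edgeCount E                           ≡⟨ cong (λ z → (free + z) ∸ edgeCount E) (edgeCount-rows E mE) ⟩
    (free + sumFin (λ i → ind (occupied i))) ∸ edgeCount E       ≡⟨ cong (_∸ edgeCount E) (sym (sumFin-+ (λ i → ind (freeRow E i)) (λ i → ind (occupied i)))) ⟩
    sumFin (λ i → ind (freeRow E i) + ind (occupied i)) ∸ edgeCount E ≡⟨ cong (_∸ edgeCount E) (trans (sumFin-cong (λ i → ind-not (occupied i))) (trans (sumFin-const {n} 1) (NP.*-identityʳ n))) ⟩
    n ∸ edgeCount E                                              ∎
    where
    free = sumFin (λ i → ind (freeRow E i))
    occupied = λ i → anyFin (λ j → E i j)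

  edgeCount-⊆ : ∀ (M G : EdgeSet n) → M ⊆ₑ G →
    edgeCount G ≡ edgeCount M + sumFin (λ a → sumFin (λ b → ind (G a b ∧ not (M a b))))
  edgeCount-⊆ M G sub = trans
    (sumFin-cong (λ a → trans (sumFin-cong (λ b → split a b)) (sumFin-+ (λ b → ind (M a b)) (λ b → ind (G a b ∧ not (M a b))))))
    (sumFin-+ (λ a → sumFin (λ b → ind (M a b))) (λ a → sumFin (λ b → ind (G a b ∧ not (M a b)))))
    where
    split : ∀ a b → ind (G a b) ≡ ind (M a b) + ind (G a b ∧ not (M a b))
    split a b with M a b in e
    ... | true rewrite sub a b e = refl
    ... | false = cong ind (sym (BP.∧-identityʳ (G a b)))

counterexample : ∀ {m} {R : Fin m → Fin m → Fin m → Set} → (∀ i j l → Dec (R i j l)) →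
  ¬ (∀ i j l → R i j l) → Σ (Fin m) λ i → Σ (Fin m) λ j → Σ (Fin m) λ l → ¬ R i j l
counterexample {m} R? h with FP.¬∀⟶∃¬ m _ (λ i → FP.all? λ j → FP.all? λ l → R? i j l) h
... | i , h₁ with FP.¬∀⟶∃¬ m _ (λ j → FP.all? (R? i j)) h₁
... | j , h₂ with FP.¬∀⟶∃¬ m _ (R? i j) h₂
... | l , h₃ = i , j , l , h₃

refute : ∀ {A B C : Set} → Dec A → Dec B → Dec C → ¬ (A → B → C) → A × B × ¬ C
refute (yes a) (yes b) (no ¬c) h = a , b , ¬c
refute (yes a) (yes b) (yes c) h = ⊥-elim (h (λ _ _ → c))
refute (yes a) (no ¬b) _       h = ⊥-elim (h (λ _ b → ⊥-elim (¬b b)))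
refute (no ¬a) _       _       h = ⊥-elim (h (λ a → ⊥-elim (¬a a)))

module _ {n : ℕ} where

  -- If the axiom a is a single monomial ν dividing x_X, then
  -- x_X − x_X/ν · a = 0, so x_X ⇝ 0 in degree |X|.
  killBy : ∀ {d} (X : EdgeSet n) (a : Axiom n) (ν : Mono n) →
    axPoly a ≡ (1ℚ *q 1ℚ , ν) ∷ [] → (∀ i j → ν i j ≤ monoOf X i j) → edgeCount X ≤ d →
    emb (X ∷ []) ⇝[ d ] []
  killBy {d} X a ν single ν∣X deg = derivation ((a , q) ∷ [] , degree ∷ [] , cancels)
    where
    quotient : Mono n
    quotient i j = monoOf X i j ∸ ν i j
    q : Poly n
    q = (Q.- 1ℚ , quotient) ∷ []
    product : Mono n
    product i j = quotient i j + ν i j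
    product≡X : ∀ i j → product i j ≡ monoOf X i j
    product≡X i j = NP.m∸n+n≡m (ν∣X i j)
    qa : q *ₚ axPoly a ≡ (Q.- 1ℚ *q (1ℚ *q 1ℚ) , product) ∷ []
    qa rewrite single = refl
    degree : DegLE (q *ₚ axPoly a) d
    degree rewrite qa = degLE-terms _ d (subst (_≤ d) (sym (totalDeg-cong product (monoOf X) product≡X)) deg ∷ [])
    cancels : (emb (X ∷ []) ++ ((q *ₚ axPoly a) ++ [])) ≈ₚ []
    cancels m rewrite qa = begin
      coeff ((1ℚ , monoOf X) ∷ (c , product) ∷ []) m        ≡⟨ coeff-∷ 1ℚ (monoOf X) _ m ⟩
      1ℚ *q δ (monoOf X) m +q coeff ((c , product) ∷ []) m  ≡⟨ cong (1ℚ *q δ (monoOf X) m +q_) (trans (coeff-∷ c product [] m) (QP.+-identityʳ _)) ⟩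
      1ℚ *q δ (monoOf X) m +q c *q δ product m              ≡⟨ cong (λ z → 1ℚ *q δ (monoOf X) m +q c *q z) (δ-cong product (monoOf X) m product≡X) ⟩
      1ℚ *q δ (monoOf X) m +q c *q δ (monoOf X) m           ≡⟨ δ-cancel 1ℚ c (monoOf X) m refl ⟩
      0ℚ                                                    ∎
      where c = Q.- 1ℚ *q (1ℚ *q 1ℚ)

  data Clash (X : EdgeSet n) : Set where
    rowClash : ∀ i j l → j ≢ l → X i j ≡ true → X i l ≡ true → Clash X
    colClash : ∀ i l j → i ≢ l → X i j ≡ true → X l j ≡ true → Clash X

  rowOK : ∀ (X : EdgeSet n) i j l → Dec (X i j ≡ true → X i l ≡ true → j ≡ l)
  rowOK X i j l = (X i j BP.≟ true) →-dec ((X i l BP.≟ true) →-dec (j FP.≟ l))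

  colOK : ∀ (X : EdgeSet n) i l j → Dec (X i j ≡ true → X l j ≡ true → i ≡ l)
  colOK X i l j = (X i j BP.≟ true) →-dec ((X l j BP.≟ true) →-dec (i FP.≟ l))

  clash : ∀ (X : EdgeSet n) → ¬ IsMatching X → Clash X
  clash X notM with FP.all? (λ i → FP.all? (λ j → FP.all? (λ l → rowOK X i j l)))
  ... | no ¬rows with counterexample (rowOK X) ¬rows
  ...   | i , j , l , bad with refute (X i j BP.≟ true) (X i l BP.≟ true) (j FP.≟ l) bad
  ...     | xj , xl , j≢l = rowClash i j l j≢l xj xl
  clash X notM | yes rows with counterexample (colOK X) (λ cols → notM (rows , cols))
  ...   | i , l , j , bad with refute (X i j BP.≟ true) (X l j BP.≟ true) (i FP.≟ l) bad
  ...     | xi , xl , i≢l = colClash i l j i≢l xi xl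

  twoEdges-divide : ∀ (X : EdgeSet n) i j i′ j′ → ¬ (i ≡ i′ × j ≡ j′) → X i j ≡ true → X i′ j′ ≡ true →
    ∀ a b → unitMono i j a b + unitMono i′ j′ a b ≤ monoOf X a b
  twoEdges-divide X i j i′ j′ distinct x x′ a b with at-or-off a b i j | at-or-off a b i′ j′
  ... | inj₁ (refl , refl) | inj₁ (refl , refl) = ⊥-elim (distinct (refl , refl))
  ... | inj₁ (refl , refl) | inj₂ off′ rewrite at-self i j | off′ | x = s≤s z≤n
  ... | inj₂ off | inj₁ (refl , refl) rewrite off | at-self i′ j′ | x′ = s≤s z≤n
  ... | inj₂ off | inj₂ off′ rewrite off | off′ = z≤n

  killNonMatching : ∀ {d} (X : EdgeSet n) → ¬ IsMatching X → edgeCount X ≤ d → emb (X ∷ []) ⇝[ d ] []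
  killNonMatching X notM deg with clash X notM
  ... | rowClash i j l j≢l xj xl =
    killBy X (rowPair i j l j≢l) _ refl (twoEdges-divide X i j i l (λ e → j≢l (proj₂ e)) xj xl) deg
  ... | colClash i l j i≢l xi xl =
    killBy X (colPair i l j i≢l) _ refl (twoEdges-divide X i j l j (λ e → i≢l (proj₁ e)) xi xl) deg

  ⇝-keepMatchings : ∀ {d} Xs → All (λ X → edgeCount X ≤ d) Xs → emb Xs ⇝[ d ] emb (filter isMatching? Xs)
  ⇝-keepMatchings []       []           = ⇝-refl
  ⇝-keepMatchings {d} (X ∷ Xs) (deg ∷ degs) with isMatching? X
  ... | yes mX  = subst (λ Ys → emb (X ∷ Xs) ⇝[ d ] emb Ys) (sym (LP.filter-accept isMatching? mX))
    (⇝-++ {F = emb (X ∷ [])} {G = emb (X ∷ [])} ⇝-refl (⇝-keepMatchings Xs degs))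
  ... | no notM = subst (λ Ys → emb (X ∷ Xs) ⇝[ d ] emb Ys) (sym (LP.filter-reject isMatching? notM))
    (⇝-++ {F = emb (X ∷ [])} (killNonMatching X notM deg) (⇝-keepMatchings Xs degs))

  -- Expanding a free row i with the row axiom Σ_b x_ib − 1:
  --   x_E + x_E · (Σ_b x_ib − 1) = Σ_b x_{E ∪ {ib}}.
  rowExpansion : ∀ {d} (E : EdgeSet n) i → freeRow E i ≡ true → suc (edgeCount E) ≤ d →
    emb (E ∷ []) ⇝[ d ] emb (map (addE E i) (L.allFin n))
  rowExpansion {d} E i fr deg = derivation ((rowSum i , emb (E ∷ [])) ∷ [] , degree ∷ [] , expands)
    where
    xE = monoOf E
    times : ℚ × Mono n → ℚ × Mono n
    times = λ { (b , ν) → 1ℚ *q b , (λ a c → xE a c + ν a c) }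
    rowVars : List (Fin n) → Poly n
    rowVars = concatMap (λ j → var i j)
    minusOne : Poly n
    minusOne = constₚ (Q.- 1ℚ)
    -- each term of the product has degree |E| + 1 or |E|
    degree : DegLE (emb (E ∷ []) *ₚ axPoly (rowSum i)) d
    degree = degLE-terms _ d (AllP.++⁺ (AllP.map⁺ (AllP.++⁺ (varTerms (L.allFin n)) constTerm)) [])
      where
      varTerms : ∀ js → All (λ t → totalDeg (λ a c → xE a c + proj₂ t a c) ≤ d) (rowVars js)
      varTerms []       = []
      varTerms (j ∷ js) = subst (_≤ d) (sym (trans (totalDeg-+ xE (unitMono i j))
        (trans (cong (edgeCount E +_) (totalDeg-unitMono i j)) (NP.+-comm (edgeCount E) 1)))) deg ∷ varTerms js
      constTerm : All (λ t → totalDeg (λ a c → xE a c + proj₂ t a c) ≤ d) minusOne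
      constTerm = subst (_≤ d) (sym (totalDeg-cong _ xE (λ a c → NP.+-identityʳ (xE a c))))
        (NP.≤-trans (NP.n≤1+n _) deg) ∷ []
    -- x_E · x_ib = x_{E ∪ {ib}}, since the row is free
    varProducts : ∀ js m → coeff (map times (rowVars js)) m ≡ coeff (emb (map (addE E i) js)) m
    varProducts []       m = refl
    varProducts (j ∷ js) m = begin
      coeff (times (1ℚ , unitMono i j) ∷ map times (rowVars js)) m
        ≡⟨ coeff-∷ (1ℚ *q 1ℚ) _ _ m ⟩
      (1ℚ *q 1ℚ) *q δ (λ a c → xE a c + unitMono i j a c) m +q coeff (map times (rowVars js)) m
        ≡⟨ cong₂ (λ u v → u *q v +q coeff (map times (rowVars js)) m) (QP.*-identityˡ 1ℚ)
                  (δ-cong _ _ m (monoOf-addE E i j (freeRow-sound E i fr j))) ⟩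
      1ℚ *q δ (monoOf (addE E i j)) m +q coeff (map times (rowVars js)) m
        ≡⟨ cong (1ℚ *q δ (monoOf (addE E i j)) m +q_) (varProducts js m) ⟩
      1ℚ *q δ (monoOf (addE E i j)) m +q coeff (emb (map (addE E i) js)) m
        ≡⟨ sym (coeff-∷ 1ℚ _ _ m) ⟩
      coeff (emb (map (addE E i) (j ∷ js))) m ∎
    expands : (emb (E ∷ []) ++ ((emb (E ∷ []) *ₚ axPoly (rowSum i)) ++ [])) ≈ₚ emb (map (addE E i) (L.allFin n))
    expands m = begin
      coeff ((1ℚ , xE) ∷ ((map times (rowVars allFin ++ minusOne) ++ []) ++ [])) m
        ≡⟨ coeff-∷ 1ℚ xE _ m ⟩
      A +q coeff ((map times (rowVars allFin ++ minusOne) ++ []) ++ []) m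
        ≡⟨ cong (λ p → A +q coeff p m) (trans (LP.++-identityʳ _) (trans (LP.++-identityʳ _) (LP.map-++ times (rowVars allFin) minusOne))) ⟩
      A +q coeff (map times (rowVars allFin) ++ map times minusOne) m
        ≡⟨ cong (A +q_) (coeff-++ (map times (rowVars allFin)) (map times minusOne) m) ⟩
      A +q (B +q coeff (map times minusOne) m)
        ≡⟨ cong (λ z → A +q (B +q z)) (trans (coeff-∷ _ _ [] m) (trans (QP.+-identityʳ _)
             (cong (1ℚ *q Q.- 1ℚ *q_) (δ-cong _ xE m (λ a c → NP.+-identityʳ (xE a c)))))) ⟩
      A +q (B +q Cc)
        ≡⟨ solve 3 (λ A B Cc → A :+ (B :+ Cc) := B :+ (A :+ Cc)) refl A B Cc ⟩
      B +q (A +q Cc)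
        ≡⟨ cong (B +q_) (δ-cancel 1ℚ (1ℚ *q Q.- 1ℚ) xE m refl) ⟩
      B +q 0ℚ
        ≡⟨ QP.+-identityʳ B ⟩
      B
        ≡⟨ varProducts allFin m ⟩
      coeff (emb (map (addE E i) allFin)) m ∎
      where
      allFin = L.allFin n
      A  = 1ℚ *q δ xE m
      B  = coeff (map times (rowVars allFin)) m
      Cc = (1ℚ *q Q.- 1ℚ) *q δ xE m

module Extensions {n : ℕ} (M : EdgeSet n) {d : ℕ} (|M|≡d : edgeCount M ≡ d) where

  Ext : ℕ → EdgeSet n → Set
  Ext k X = IsMatching X × (M ⊆ₑ X) × (edgeCount X ≡ k)

  Ext? : ∀ k X → Dec (Ext k X)
  Ext? k X = isMatching? X ×-dec (M ⊆ₑ? X) ×-dec (edgeCount X N.≟ k)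

  S : ℕ → Poly n
  S k = emb (extensions M k)

  extensions-Ext : ∀ k → All (Ext k) (extensions M k)
  extensions-Ext k = AllP.all-filter (Ext? k) (allEdgeSets n)

  mult-extensions : ∀ k G → mult (extensions M k) G ≡ ind (does (Ext? k G))
  mult-extensions k = mult-filter (Ext? k) (λ e (mX , sub , ec) →
    IsMatching-≅ e mX , (λ a b h → trans (sym (e a b)) (sub a b h)) , trans (sym (edgeCount-≅ e)) ec)

  mult-extensions-d : IsMatching M → ∀ G → mult (extensions M d) G ≡ 1 * mult (M ∷ []) G
  mult-extensions-d mM G = begin
    mult (extensions M d) G   ≡⟨ mult-extensions d G ⟩
    ind (does (Ext? d G))     ≡⟨ cong ind (does-reflects (eqB M G) (Ext? d G) isM fromM) ⟩
    ind (eqB M G)             ≡⟨ sym (trans (NP.*-identityˡ _) (NP.+-identityʳ _)) ⟩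
    1 * mult (M ∷ []) G       ∎
    where
    fromM : eqB M G ≡ true → Ext d G
    fromM h = let e = eqB-sound M G h in
      IsMatching-≅ e mM , (λ a b m → trans (sym (e a b)) m) , trans (sym (edgeCount-≅ e)) |M|≡d
    isM : Ext d G → eqB M G ≡ true
    isM (_ , sub , ec) = eqB-complete M G same
      where
      nothingElse : sumFin (λ a → sumFin (λ b → ind (G a b ∧ not (M a b)))) ≡ 0
      nothingElse = NP.+-cancelˡ-≡ (edgeCount M) _ 0
        (trans (sym (edgeCount-⊆ M G sub)) (trans ec (trans (sym |M|≡d) (sym (NP.+-identityʳ _)))))
      same : M ≅ G
      same a b with M a b in e
      ... | true = sym (sub a b e)
      ... | false with G a b in e′
      ...   | false = refl
      ...   | true with sumFin-zero _ (sumFin-zero _ nothingElse a) b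
      ...     | none rewrite e | e′ = ⊥-elim (NP.1+n≢0 none)

  addE-delE : ∀ (G : EdgeSet n) → IsMatching G → ∀ E i b →
    (freeRow E i ∧ eqB (addE E i b) G) ≡ (G i b ∧ eqB E (delE G i b))
  addE-delE G (r , _) E i b = bool-iff fwd bwd
    where
    fwd : freeRow E i ∧ eqB (addE E i b) G ≡ true → G i b ∧ eqB E (delE G i b) ≡ true
    fwd h = ∧-intro gib (eqB-complete E (delE G i b) same)
      where
      fr  = freeRow-sound E i (proj₁ (∧-true h))
      eq  = eqB-sound _ _ (proj₂ (∧-true {freeRow E i} h))
      gib = trans (sym (eq i b)) (addE-at E i b)
      same : E ≅ delE G i b
      same a c with at-or-off a c i b
      ... | inj₁ (refl , refl) = trans (fr b) (sym (delE-at G i b))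
      ... | inj₂ off = trans (sym (addE-off E i b a c off)) (trans (eq a c) (sym (delE-off G i b a c off)))
    bwd : G i b ∧ eqB E (delE G i b) ≡ true → freeRow E i ∧ eqB (addE E i b) G ≡ true
    bwd h = ∧-intro (cong not (anyFin-false-intro (λ c → E i c) fr)) (eqB-complete (addE E i b) G same)
      where
      gib = proj₁ (∧-true h)
      eq  = eqB-sound _ _ (proj₂ (∧-true {G i b} h))
      -- the only edge of G in row i is ib, which E lacks
      fr : ∀ c → E i c ≡ false
      fr c with at-or-off i c i b
      ... | inj₁ (_ , refl) = trans (eq i b) (delE-at G i b)
      ... | inj₂ off with G i c in e
      ...   | false = trans (eq i c) (trans (delE-off G i b i c off) e)
      ...   | true with refl ← r i c b e gib = ⊥-elim (t≢f (trans (sym (at-self i c)) off))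
      same : addE E i b ≅ G
      same a c with at-or-off a c i b
      ... | inj₁ (refl , refl) = trans (addE-at E i b) (sym gib)
      ... | inj₂ off = trans (addE-off E i b a c off) (trans (eq a c) (delE-off G i b a c off))

  Ext-delE : ∀ k (G : EdgeSet n) i b → IsMatching G → G i b ≡ true →
    does (Ext? k (delE G i b)) ≡ not (M i b) ∧ does (Ext? (suc k) G)
  Ext-delE k G i b mG gib = does-reflects _ (Ext? k (delE G i b)) toExt fromExt
    where
    toExt : Ext k (delE G i b) → not (M i b) ∧ does (Ext? (suc k) G) ≡ true
    toExt (_ , sub , ec) = ∧-intro (cong not notInM)
      (does-complete (Ext? (suc k) G) (mG , (λ a c h → proj₁ (∧-true (sub a c h))) , trans (edgeCount-delE G i b gib) (cong suc ec)))
      where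
      notInM : M i b ≡ false
      notInM with M i b in e
      ... | false = refl
      ... | true  = ⊥-elim (t≢f (trans (sym (sub i b e)) (delE-at G i b)))
    fromExt : not (M i b) ∧ does (Ext? (suc k) G) ≡ true → Ext k (delE G i b)
    fromExt h = delE-matching G i b mG , sub′ , NP.suc-injective (trans (sym (edgeCount-delE G i b gib)) ec)
      where
      notInM = not-true (M i b) (proj₁ (∧-true h))
      ext = does-sound (Ext? (suc k) G) (proj₂ (∧-true {not (M i b)} h))
      ec  = proj₂ (proj₂ ext)
      sub′ : M ⊆ₑ delE G i b
      sub′ a c mac with at-or-off a c i b
      ... | inj₁ (refl , refl) = ⊥-elim (t≢f (trans (sym mac) notInM))
      ... | inj₂ off = trans (delE-off G i b a c off) (proj₁ (proj₂ ext) a c mac)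

  copies : EdgeSet n → List (EdgeSet n)
  copies E = concatMap (λ i → if freeRow E i then E ∷ [] else []) (L.allFin n)

  expansions : EdgeSet n → List (EdgeSet n)
  expansions E = concatMap (λ i → if freeRow E i then map (addE E i) (L.allFin n) else []) (L.allFin n)

  -- A matching with j edges has n − j free rows, hence n − j copies.
  mult-copies : ∀ j G → mult (concatMap copies (extensions M j)) G ≡ (n ∸ j) * mult (extensions M j) G
  mult-copies j G = trans (sumL-concatMap _ copies (extensions M j))
    (trans (sumL-All perMatching (extensions-Ext j)) (sumL-*ˡ (n ∸ j) (λ E → ind (eqB E G)) (extensions M j)))
    where
    perMatching : ∀ E → Ext j E → mult (copies E) G ≡ (n ∸ j) * ind (eqB E G)
    perMatching E (mE , _ , ec) = begin
      mult (copies E) G                                          ≡⟨ sumL-concatMap _ _ (L.allFin n) ⟩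
      sumL (λ i → countB p (if freeRow E i then E ∷ [] else [])) (L.allFin n)
                                                                 ≡⟨ sumL-allFin (λ i → countB p (if freeRow E i then E ∷ [] else [])) ⟩
      sumFin (λ i → countB p (if freeRow E i then E ∷ [] else [])) ≡⟨ sumFin-cong (λ i → countB-if p (freeRow E i) (E ∷ [])) ⟩
      sumFin (λ i → ind (freeRow E i) * countB p (E ∷ []))       ≡⟨ sumFin-*ʳ (λ i → ind (freeRow E i)) _ ⟩
      sumFin (λ i → ind (freeRow E i)) * countB p (E ∷ [])       ≡⟨ cong₂ _*_ (trans (freeRows-count E mE) (cong (n ∸_) ec)) (NP.+-identityʳ _) ⟩
      (n ∸ j) * ind (eqB E G)                                    ∎
      where p = λ X → eqB X G

  -- Each row expansion is an instance of the row axiom.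
  ⇝-expansions : ∀ {j} E → edgeCount E ≡ j → emb (copies E) ⇝[ suc j ] emb (expansions E)
  ⇝-expansions {j} E ec = ⇝-concatMap _ _ (AllP.tabulate⁺ (λ i → row i (freeRow E i) refl))
    where
    row : ∀ i b → freeRow E i ≡ b →
      emb (if b then E ∷ [] else []) ⇝[ suc j ] emb (if b then map (addE E i) (L.allFin n) else [])
    row i true  fr = rowExpansion E i fr (NP.≤-reflexive (cong suc ec))
    row i false _  = ⇝-refl

  expansions-degree : ∀ j → All (λ X → edgeCount X ≤ suc j) (concatMap expansions (extensions M j))
  expansions-degree j = AllP.concat⁺ (AllP.map⁺ (All.map perMatching (extensions-Ext j)))
    where
    perMatching : ∀ {E} → Ext j E → All (λ X → edgeCount X ≤ suc j) (expansions E)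
    perMatching {E} (_ , _ , ec) = AllP.concat⁺ (AllP.map⁺ (AllP.tabulate⁺ (λ i → row i (freeRow E i) refl)))
      where
      row : ∀ i b → freeRow E i ≡ b → All (λ X → edgeCount X ≤ suc j) (if b then map (addE E i) (L.allFin n) else [])
      row i true  fr = AllP.map⁺ (AllP.tabulate⁺ (λ b →
        NP.≤-reflexive (trans (edgeCount-addE E i b (freeRow-sound E i fr b)) (cong suc ec))))
      row i false _  = []

  hit : EdgeSet n → EdgeSet n → Fin n → Fin n → ℕ
  hit G E i b = ind (G i b ∧ eqB E (delE G i b))

  mult-expansions-of : ∀ G → IsMatching G → ∀ E → mult (expansions E) G ≡ sumFin (λ i → sumFin (λ b → hit G E i b))
  mult-expansions-of G mG E = trans (sumL-concatMap _ _ (L.allFin n)) (trans (sumL-allFin (λ i → countB p (if freeRow E i then map (addE E i) (L.allFin n) else []))) (sumFin-cong row))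
    where
    p = λ X → eqB X G
    row : ∀ i → countB p (if freeRow E i then map (addE E i) (L.allFin n) else []) ≡ sumFin (λ b → hit G E i b)
    row i = begin
      countB p (if freeRow E i then map (addE E i) (L.allFin n) else [])  ≡⟨ countB-if p (freeRow E i) _ ⟩
      ind (freeRow E i) * countB p (map (addE E i) (L.allFin n))          ≡⟨ cong (ind (freeRow E i) *_) (trans (sumL-map _ (addE E i) (L.allFin n)) (sumL-allFin (λ b → ind (p (addE E i b))))) ⟩
      ind (freeRow E i) * sumFin (λ b → ind (p (addE E i b)))             ≡⟨ sym (sumFin-*ˡ (ind (freeRow E i)) (λ b → ind (p (addE E i b)))) ⟩
      sumFin (λ b → ind (freeRow E i) * ind (p (addE E i b)))             ≡⟨ sumFin-cong (λ b → trans (sym (ind-∧ (freeRow E i) _)) (cong ind (addE-delE G mG E i b))) ⟩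
      sumFin (λ b → hit G E i b)                                          ∎

  hits-of-edge : ∀ j G → IsMatching G → ∀ i b →
    sumL (λ E → hit G E i b) (extensions M j) ≡ ind (G i b ∧ not (M i b)) * ind (does (Ext? (suc j) G))
  hits-of-edge j G mG i b with G i b in gib
  ... | false = countB-false _ (λ _ → refl) (extensions M j)
  ... | true  = begin
    mult (extensions M j) (delE G i b)           ≡⟨ mult-extensions j (delE G i b) ⟩
    ind (does (Ext? j (delE G i b)))             ≡⟨ cong ind (Ext-delE j G i b mG gib) ⟩
    ind (not (M i b) ∧ does (Ext? (suc j) G))    ≡⟨ ind-∧ (not (M i b)) _ ⟩
    ind (not (M i b)) * ind (does (Ext? (suc j) G)) ∎

  newEdges : ∀ j G → Ext (suc j) G → sumFin (λ i → sumFin (λ b → ind (G i b ∧ not (M i b)))) ≡ suc j ∸ d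
  newEdges j G (_ , sub , ec) = begin
    new                                ≡⟨ sym (NP.m+n∸m≡n (edgeCount M) new) ⟩
    (edgeCount M + new) ∸ edgeCount M  ≡⟨ cong (_∸ edgeCount M) (sym (edgeCount-⊆ M G sub)) ⟩
    edgeCount G ∸ edgeCount M          ≡⟨ cong₂ _∸_ ec |M|≡d ⟩
    suc j ∸ d                          ∎
    where new = sumFin (λ i → sumFin (λ b → ind (G i b ∧ not (M i b))))

  mult-expansions : ∀ j G → IsMatching G →
    mult (concatMap expansions (extensions M j)) G ≡ (suc j ∸ d) * ind (does (Ext? (suc j) G))
  mult-expansions j G mG = begin
    mult (concatMap expansions (extensions M j)) G              ≡⟨ sumL-concatMap _ expansions (extensions M j) ⟩
    sumL (λ E → mult (expansions E) G) (extensions M j)         ≡⟨ sumL-cong (mult-expansions-of G mG) (extensions M j) ⟩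
    sumL (λ E → sumFin (λ i → sumFin (hit G E i))) (extensions M j)
                                                                ≡⟨ sumL-sumFin (λ E i → sumFin (hit G E i)) (extensions M j) ⟩
    sumFin (λ i → sumL (λ E → sumFin (hit G E i)) (extensions M j))
                                                                ≡⟨ sumFin-cong (λ i → sumL-sumFin (λ E → hit G E i) (extensions M j)) ⟩
    sumFin (λ i → sumFin (λ b → sumL (λ E → hit G E i b) (extensions M j)))
                                                                ≡⟨ sumFin-cong (λ i → sumFin-cong (hits-of-edge j G mG i)) ⟩
    sumFin (λ i → sumFin (λ b → ind (G i b ∧ not (M i b)) * c)) ≡⟨ sumFin-cong (λ i → sumFin-*ʳ (λ b → ind (G i b ∧ not (M i b))) c) ⟩
    sumFin (λ i → sumFin (λ b → ind (G i b ∧ not (M i b))) * c) ≡⟨ sumFin-*ʳ (λ i → sumFin (λ b → ind (G i b ∧ not (M i b)))) c ⟩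
    sumFin (λ i → sumFin (λ b → ind (G i b ∧ not (M i b)))) * c ≡⟨ count (Ext? (suc j) G) ⟩
    (suc j ∸ d) * c                                             ∎
    where
    c = ind (does (Ext? (suc j) G))
    count : (D : Dec (Ext (suc j) G)) → sumFin (λ i → sumFin (λ b → ind (G i b ∧ not (M i b)))) * ind (does D) ≡ (suc j ∸ d) * ind (does D)
    count (yes ext) = cong (_* 1) (newEdges j G ext)
    count (no _)    = trans (NP.*-zeroʳ (sumFin (λ i → sumFin (λ b → ind (G i b ∧ not (M i b)))))) (sym (NP.*-zeroʳ (suc j ∸ d)))

  mult-matchingExpansions : ∀ j G →
    mult (filter isMatching? (concatMap expansions (extensions M j))) G ≡ (suc j ∸ d) * mult (extensions M (suc j)) G
  mult-matchingExpansions j G = trans (countB-filter isMatching? _ Ts) (trans (byMatching (isMatching? G))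
    (cong ((suc j ∸ d) *_) (sym (mult-extensions (suc j) G))))
    where
    Ts = concatMap expansions (extensions M j)
    byMatching : Dec (IsMatching G) → countB (λ X → does (isMatching? X) ∧ eqB X G) Ts ≡ (suc j ∸ d) * ind (does (Ext? (suc j) G))
    byMatching (yes mG) = trans (sumL-cong (λ X → cong ind (bool-iff (λ h → proj₂ (∧-true h))
      (λ h → ∧-intro (does-complete (isMatching? X) (IsMatching-≅ (≅-sym (eqB-sound X G h)) mG)) h))) Ts)
      (mult-expansions j G mG)
    byMatching (no ¬mG) = trans (countB-false _ notHit Ts)
      (sym (trans (cong (λ z → (suc j ∸ d) * ind z) (does-false (Ext? (suc j) G) (λ e → ¬mG (proj₁ e)))) (NP.*-zeroʳ (suc j ∸ d))))
      where
      notHit : ∀ X → does (isMatching? X) ∧ eqB X G ≡ false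
      notHit X with eqB X G in e
      ... | false = BP.∧-zeroʳ _
      ... | true rewrite does-false (isMatching? X) (λ mX → ¬mG (IsMatching-≅ (eqB-sound X G e) mX)) = refl

  step : ∀ j → scale (ι (n ∸ j)) (S j) ⇝[ suc j ] scale (ι (suc j ∸ d)) (S (suc j))
  step j =
    scale (ι (n ∸ j)) (S j)                                ≈˘⟨ emb-proportional (n ∸ j) (concatMap copies (extensions M j)) (extensions M j) (mult-copies j) ⟩
    emb (concatMap copies (extensions M j))               ⇝⟨ ⇝-concatMap copies expansions
                                                               (All.map (λ (_ , _ , ec) → ⇝-expansions _ ec) (extensions-Ext j)) ⟩
    emb (concatMap expansions (extensions M j))           ⇝⟨ ⇝-keepMatchings _ (expansions-degree j) ⟩
    emb (filter isMatching? (concatMap expansions (extensions M j)))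
                                                          ≈⟨ emb-proportional (suc j ∸ d) (filter isMatching? (concatMap expansions (extensions M j))) (extensions M (suc j)) (mult-matchingExpansions j) ⟩
    scale (ι (suc j ∸ d)) (S (suc j))                      ∎ₚ

  chain : IsMatching M → ∀ t {k} → t + d ≤ k → scale (ι ((n ∸ d) C t)) (xM M) ⇝[ k ] S (t + d)
  chain mM zero    _  = ≈⇒⇝ (λ m → sym (emb-proportional 1 (extensions M d) (M ∷ []) (mult-extensions-d mM) m))
  chain mM (suc t) le =
    scale (ι (a C suc t)) (xM M)
      ⇝⟨ ⇝-divide (suc t) (s≤s z≤n) (
        scale (ι (suc t)) (scale (ι (a C suc t)) (xM M))   ≈⟨ scale-ι-∘ (suc t) (a C suc t) (xM M) ⟩
        scale (ι (suc t * (a C suc t))) (xM M)             ≈⟨ scale-cong (xM M) (cong ι absorbed) ⟩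
        scale (ι ((n ∸ j) * (a C t))) (xM M)               ≈˘⟨ scale-ι-∘ (n ∸ j) (a C t) (xM M) ⟩
        scale (ι (n ∸ j)) (scale (ι (a C t)) (xM M))       ⇝⟨ ⇝-scale (ι (n ∸ j)) (chain mM t (NP.≤-trans (NP.n≤1+n j) le)) ⟩
        scale (ι (n ∸ j)) (S j)                            ⇝⟨ ⇝-weaken le (step j) ⟩
        scale (ι (suc j ∸ d)) (S (suc j))                  ≈⟨ scale-cong (S (suc j)) (cong ι (NP.m+n∸n≡m (suc t) d)) ⟩
        scale (ι (suc t)) (S (suc j))                      ∎ₚ) ⟩
    scale (invℕ (suc t)) (scale (ι (suc t)) (S (suc j)))   ≈⟨ scale-inverse t (S (suc j)) ⟩
    S (suc j)                                              ∎ₚ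
    where
    a = n ∸ d
    j = t + d
    absorbed : suc t * (a C suc t) ≡ (n ∸ j) * (a C t)
    absorbed = trans (absorption a t)
      (cong (_* (a C t)) (trans (NP.∸-+-assoc n d t) (cong (n ∸_) (NP.+-comm d t))))

mainTheorem15 : (n : ℕ) → 0 < n → (d k : ℕ) → (M : EdgeSet n) → IsMatching M → coveredCount M ≡ 2 * d → d ≤ k → k ≤ n → Derives n k (xM M) (rhsPoly n d k M)
mainTheorem15 n _ d k M mM cov d≤k k≤n = derives (
  xM M                         ⇝⟨ ⇝-divide binom (C-pos (n ∸ d) (k ∸ d) (NP.∸-monoˡ-≤ d k≤n)) toSₖ ⟩
  scale (invℕ binom) (S k)     ≈⟨ scale-emb (invℕ binom) (extensions M k) ⟩
  rhsPoly n d k M              ∎ₚ)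
  where
  binom = (n ∸ d) C (k ∸ d)
  |M|≡d : edgeCount M ≡ d
  |M|≡d = NP.*-cancelˡ-≡ (edgeCount M) d 2 (trans (sym (coveredCount-matching M mM)) cov)
  open Extensions M |M|≡d
  toSₖ : scale (ι binom) (xM M) ⇝[ k ] S k
  toSₖ = subst (λ j → scale (ι binom) (xM M) ⇝[ k ] S j) (NP.m∸n+n≡m d≤k)
    (chain mM (k ∸ d) (NP.≤-reflexive (NP.m∸n+n≡m d≤k)))
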